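{- Let $G\in\mathrm{Mat}_{k\times n}(\mathbb{Z})$ have no zero column, with lcm period $\rho_0$. For every $m\in\{1,\dots,\rho_0\}$, $$f^m_{d'_m}(t)=\sum_{J\subseteq E,\ |J|=n-d'_m}\left(\frac{\prod_{\ell=1}^{r(J)}\gcd(m,e_{\ell,J})}{\prod_{\ell=1}^{r(E)}\gcd(m,e_{\ell,E})}\,t^{r(E)-r(J)}-1\right).$$
   Context: $E=\{1,\dots,n\}$. For nonempty $J\subseteq E$, $r(J)$ is the rank of the submatrix $G_J$ of columns indexed by $J$ and $e_{1,J}\mid\cdots\mid e_{r(J),J}$ its elementary divisors; $r(\emptyset)=0$; empty products equal $1$. $\rho_0:=\mathrm{lcm}(e_{r(J),J}\mid\emptyset\ne J\subseteq E)$. For $m\in\{1,\dots,\rho_0\}$ and $i\in\{0,\dots,n\}$, $$f_i^m(t):=\sum_{J\subseteq E,\ |J|=n-i}\ \sum_{K:\,J\subseteq K\subseteq E}(-1)^{|K|-|J|}\frac{\prod_{\ell=1}^{r(K)}\gcd(m,e_{\ell,K})}{\prod_{\ell=1}^{r(E)}\gcd(m,e_{\ell,E})}\,t^{r(E)-r(K)}\in\mathbb{Q}[t],$$ and $d'_m:=\min\{i\in\mathbb{Z}_{>0}\mid f_i^m(t)\ne0 \text{ as a polynomial}\}$. -}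

module Defs where

open import Data.Nat as ℕ using (ℕ; zero; suc; _≤_; _<_)
open import Data.Nat.Divisibility using (_∣_)
open import Data.Nat.GCD using (gcd)
open import Data.Nat.LCM using (lcm)
open import Data.Integer as ℤ using (ℤ; +_)
open import Data.Rational as ℚ using (ℚ; 0ℚ; 1ℚ)
open import Data.Fin using (Fin; zero; suc; toℕ)
open import Data.Fin.Subset using (Subset; inside; outside; ∣_∣; _⊆_)
open import Data.Fin.Subset.Properties using (_⊆?_)
open import Data.Vec using ([]; _∷_)
open import Data.List as L using (List; []; _∷_; [_]; _++_; length; lookup)
open import Data.Nat.ListAction using (product)
open import Data.List.Relation.Unary.All using (All)
open import Data.List.Relation.Unary.Linked using (Linked)
open import Data.Bool using (Bool; true; false; if_then_else_)
open import Data.Product using (_×_)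
open import Relation.Nullary using (¬_; does)
open import Relation.Binary.PropositionalEquality using (_≡_; _≢_)

Mat : ℕ → ℕ → Set
Mat k p = Fin k → Fin p → ℤ

sumFin : ∀ {p} → (Fin p → ℤ) → ℤ
sumFin {zero}  f = + 0
sumFin {suc p} f = f zero ℤ.+ sumFin (λ i → f (suc i))

_⊛_ : ∀ {a b c} → Mat a b → Mat b c → Mat a c
(A ⊛ B) i j = sumFin (λ l → A i l ℤ.* B l j)

idMat : ∀ {a} → Mat a a
idMat i j = if does (toℕ i ℕ.≟ toℕ j) then + 1 else + 0

-- entry ℓ (0-based) of a list, default 0
nth0 : List ℕ → ℕ → ℕ
nth0 []       _       = 0
nth0 (x ∷ xs) zero    = x
nth0 (x ∷ xs) (suc l) = nth0 xs l

diagMat : ∀ {k p} → List ℕ → Mat k p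
diagMat es i j = if does (toℕ i ℕ.≟ toℕ j) then + nth0 es (toℕ i) else + 0

-- Smith normal form over ℤ: U M V = diag(e₁,…,e_r,0,…) with U,V
-- invertible over ℤ, eᵢ > 0, e₁ ∣ e₂ ∣ ⋯ ∣ e_r.  r = rank, eᵢ = elementary divisors.

record SNF {k p : ℕ} (M : Mat k p) : Set where
  field
    divs       : List ℕ
    divs-pos   : All (λ e → 0 < e) divs
    divs-chain : Linked _∣_ divs
    len≤rows   : length divs ≤ k
    len≤cols   : length divs ≤ p
    U U' : Mat k k
    V V' : Mat p p
    UU'  : ∀ i j → (U ⊛ U') i j ≡ idMat i j
    U'U  : ∀ i j → (U' ⊛ U) i j ≡ idMat i j
    VV'  : ∀ i j → (V ⊛ V') i j ≡ idMat i j
    V'V  : ∀ i j → (V' ⊛ V) i j ≡ idMat i j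
    smith : ∀ i j → ((U ⊛ M) ⊛ V) i j ≡ diagMat divs i j

  rank : ℕ
  rank = length divs

subsets : ∀ n → List (Subset n)
subsets zero    = [ [] ]
subsets (suc n) = L.map (outside ∷_) (subsets n) ++ L.map (inside ∷_) (subsets n)

elems : ∀ {n} → Subset n → List (Fin n)
elems []            = []
elems (inside ∷ p)  = zero ∷ L.map suc (elems p)
elems (outside ∷ p) = L.map suc (elems p)

cols : ∀ {k n} → Mat k n → (J : Subset n) → Mat k (length (elems J))
cols G J i c = G i (lookup (elems J) c)

full : ∀ {n} → Subset n
full {zero}  = []
full {suc n} = inside ∷ full

NoZeroColumn : ∀ {k n} → Mat k n → Set
NoZeroColumn {k} {n} G = ∀ (j : Fin n) → ¬ (∀ (i : Fin k) → G i j ≡ + 0)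

SNFs : ∀ {k n} → Mat k n → Set
SNFs {n = n} G = (J : Subset n) → SNF (cols G J)

module _ {k n : ℕ} (G : Mat k n) (s : SNFs G) where

  r : Subset n → ℕ
  r J = SNF.rank (s J)

  eds : Subset n → List ℕ
  eds J = SNF.divs (s J)

  -- last elementary divisor e_{r(J),J} (1 if none)
  lastDiv : List ℕ → ℕ
  lastDiv []           = 1
  lastDiv (x ∷ [])     = x
  lastDiv (x ∷ y ∷ xs) = lastDiv (y ∷ xs)

  ρ₀ : ℕ
  ρ₀ = L.foldr (λ J acc → if does (∣ J ∣ ℕ.≟ 0) then acc else lcm (lastDiv (eds J)) acc)
               1 (subsets n)

  gprod : ℕ → Subset n → ℕ
  gprod m J = product (L.map (gcd m) (eds J))

-- Polynomials in ℚ[t] as finite lists of monomials (coefficient, exponent)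

Poly : Set
Poly = List (ℚ × ℕ)

open import Data.Product using (_,_)

coeff : Poly → ℕ → ℚ
coeff []             d = 0ℚ
coeff ((c , e) ∷ ms) d = if does (e ℕ.≟ d) then c ℚ.+ coeff ms d else coeff ms d

_≈P_ : Poly → Poly → Set
p ≈P q = ∀ d → coeff p d ≡ coeff q d

IsZeroPoly : Poly → Set
IsZeroPoly p = ∀ d → coeff p d ≡ 0ℚ

-- a / b in ℚ (b = 0 never occurs below since m ≥ 1; convention: a/0 := 0)
frac : ℕ → ℕ → ℚ
frac a zero    = 0ℚ
frac a (suc b) = (+ a) ℚ./ suc b

sgn : ℕ → ℚ
sgn zero    = 1ℚ
sgn (suc j) = ℚ.- sgn j

module _ {k n : ℕ} (G : Mat k n) (s : SNFs G) where

  ratio : ℕ → Subset n → ℚ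
  ratio m K = frac (gprod G s m K) (gprod G s m full)

  -- f_i^m(t); the condition |J| + i = n encodes |J| = n - i (empty if i > n)
  f : ℕ → ℕ → Poly
  f i m = L.concatMap term (subsets n)
    where
    inner : Subset n → Poly
    inner J = L.concatMap (λ K → if does (J ⊆? K)
                                  then [ (sgn (∣ K ∣ ℕ.∸ ∣ J ∣) ℚ.* ratio m K , r G s full ℕ.∸ r G s K) ]
                                  else [])
                          (subsets n)
    term : Subset n → Poly
    term J = if does ((∣ J ∣ ℕ.+ i) ℕ.≟ n) then inner J else []

  rhs : ℕ → ℕ → Poly
  rhs i m = L.concatMap term (subsets n)
    where
    term : Subset n → Poly
    term J = if does ((∣ J ∣ ℕ.+ i) ℕ.≟ n)
             then (ratio m J , r G s full ℕ.∸ r G s J) ∷ (ℚ.- 1ℚ , 0) ∷ []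
             else []

  IsD' : ℕ → ℕ → Set
  IsD' m d = (1 ≤ d) × (¬ IsZeroPoly (f d m)) × (∀ i → 1 ≤ i → i < d → IsZeroPoly (f i m))

-- For q ≡ m (mod ρ₀), the Smith normal form of G_K shows that the number of
-- x ∈ (ℤ/q)^k with x·G_K ≡ 0 (mod q) is q^(k - r(E)) · g(K) · q^(r(E) - r(K)),
-- where g(K) = ∏ gcd(m, e_{ℓ,K}); only e_{ℓ,K} ∣ ρ₀ is used.  Inclusion–exclusion
-- over column sets turns this into: q^(k - r(E)) · g(E) · f_i^m(q) is the number of
-- x whose set of columns vanishing mod q has exactly n - i elements.  If f_i^m = 0
-- for 0 < i < d, these nonnegative counts are 0, so no x has between n - d and n
-- vanishing columns (exclusive).  For |J| = n - d the x vanishing on J therefore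
-- vanish on exactly J or on all of E, which is the claimed identity at t = q.  Both
-- sides are polynomials agreeing on the unbounded sequence q = m + ρ₀ N, hence equal.

module Submission where

open import Defs

open import Level using (Level)
open import Function using (_∘_; _⇔_; mk⇔)
open import Relation.Binary.Definitions using (DecidableEquality)
open import Relation.Binary.PropositionalEquality hiding ([_])
open import Relation.Nullary using (Dec; ¬_; does; yes; no; contradiction)
open import Relation.Nullary.Decidable using (dec-true; dec-false; does-⇔; _×-dec_)
open import Data.Sum using (inj₁; inj₂)
open import Data.Product using (_×_; _,_; proj₁; proj₂; uncurry)
open import Data.Bool as Bool using (Bool; true; false; _∧_; if_then_else_)
open import Data.Bool.ListAction using (all; and)
open import Data.Nat as ℕ using (ℕ; zero; suc; _∸_; _≤_; NonZero)
import Data.Nat.Properties as ℕP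
import Data.Nat.Divisibility as ℕ∣
open import Data.Nat.Divisibility using (_∣_; _∣?_)
open import Data.Nat.DivMod using (m/n*n≡m)
open import Data.Nat.GCD
  using (gcd; gcd[m,n]∣m; gcd[m,n]∣n; gcd[m,n]≢0; gcd-greatest; gcd-universality; gcd-identityʳ; gcd-zeroˡ)
open import Data.Nat.Coprimality using (coprime-/gcd; coprime-divisor)
open import Data.Nat.LCM using (lcm; m∣lcm[m,n]; n∣lcm[m,n])
open import Data.Nat.ListAction using (product)
open import Data.Nat.ListAction.Properties using (product≢0)
open import Data.Integer as ℤ using (ℤ; +_; 0ℤ; 1ℤ; -1ℤ; _+_; _*_; -_; _-_; _^_)
import Data.Integer.Properties as ℤP
import Data.Integer.Divisibility.Signed as ℤ∣
open import Data.Integer.Divisibility.Signed using () renaming (_∣_ to _∣ℤ_; _∣?_ to _∣ℤ?_)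
open import Data.Integer.DivMod using (_%ℕ_; _/ℕ_; n%ℕd<d; a≡a%ℕn+[a/ℕn]*n)
open import Data.Integer.Tactic.RingSolver using (solve-∀)
open import Data.Rational as ℚ using (ℚ; 0ℚ; 1ℚ)
import Data.Rational.Properties as ℚP
import Data.Rational.Unnormalised as ℚᵘ
import Data.Rational.Unnormalised.Properties as ℚᵘP
open import Data.Fin as Fin using (Fin; zero; suc; toℕ)
import Data.Fin.Properties as FinP
open import Data.Fin.Subset using (Subset; inside; outside; ∣_∣; _⊆_; ⊤)
import Data.Fin.Subset.Properties as SubsetP
open import Data.Fin.Subset.Properties using (_⊆?_)
open import Data.Vec as Vec using (Vec; []; _∷_)
import Data.Vec.Properties as VecP
open import Data.List as List using (List; []; _∷_; [_]; _++_; concatMap)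
import Data.List.Properties as ListP
open import Data.List.Membership.Propositional using () renaming (_∈_ to _∈ᴸ_)
open import Data.List.Membership.Propositional.Properties using (∈-map⁺; ∈-++⁺ˡ; ∈-++⁺ʳ)
open import Data.List.Relation.Unary.Any using (here; there)
open import Data.List.Relation.Unary.All as All using (All; [])
import Data.List.Relation.Unary.All.Properties as AllP
open import Data.List.Relation.Unary.Linked using (Linked; _∷_)
open import Algebra.Properties.Semiring.Sum ℤP.+-*-semiring
  using (sum; sum-syntax; sum-cong-≗; sum-remove; sum-replicate-zero; ∑-distrib-+; ∑-comm;
         *-distribˡ-sum; *-distribʳ-sum)
open import Algebra.Properties.Group ℚP.+-0-group using (inverseˡ-unique)
import Algebra.Properties.CommutativeSemigroup as CommutativeSemigroupProperties
open CommutativeSemigroupProperties ℤP.*-commutativeSemigroup using (x∙yz≈y∙xz)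
module ℕ* = CommutativeSemigroupProperties ℕP.*-commutativeSemigroup

private
  variable
    a : Level
    A B X : Set a

𝟙 : Bool → ℤ
𝟙 true  = 1ℤ
𝟙 false = 0ℤ

𝟙-nonneg : ∀ b → 0ℤ ℤ.≤ 𝟙 b
𝟙-nonneg true  = ℤ.+≤+ ℕ.z≤n
𝟙-nonneg false = ℤ.+≤+ ℕ.z≤n

𝟙-mono : ∀ {p q} {P : Set p} {Q : Set q} → (P → Q) → (P? : Dec P) (Q? : Dec Q) →
         𝟙 (does P?) ℤ.≤ 𝟙 (does Q?)
𝟙-mono _   (no _)  Q?      = 𝟙-nonneg (does Q?)
𝟙-mono _   (yes _) (yes _) = ℤP.≤-refl
𝟙-mono P⇒Q (yes p) (no ¬q) = contradiction (P⇒Q p) ¬q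

𝟙-∧ : ∀ b c → 𝟙 (b ∧ c) ≡ 𝟙 b * 𝟙 c
𝟙-∧ true  c = sym (ℤP.*-identityˡ (𝟙 c))
𝟙-∧ false c = refl

𝟙*-≤ : ∀ b {x} → 0ℤ ℤ.≤ x → 𝟙 b * x ℤ.≤ x
𝟙*-≤ true  {x} _   = ℤP.≤-reflexive (ℤP.*-identityˡ x)
𝟙*-≤ false     0≤x = 0≤x

𝟙*-nonneg : ∀ b {x} → 0ℤ ℤ.≤ x → 0ℤ ℤ.≤ 𝟙 b * x
𝟙*-nonneg true  {x} 0≤x = subst (0ℤ ℤ.≤_) (sym (ℤP.*-identityˡ x)) 0≤x
𝟙*-nonneg false     _   = ℤP.≤-refl

∑ᴸ : List A → (A → ℤ) → ℤ
∑ᴸ []       f = 0ℤ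
∑ᴸ (x ∷ xs) f = f x + ∑ᴸ xs f

syntax ∑ᴸ xs (λ x → e) = ∑[ x ∈ xs ] e

∑ᴸ-cong : ∀ (xs : List A) {f g : A → ℤ} → (∀ x → f x ≡ g x) → ∑ᴸ xs f ≡ ∑ᴸ xs g
∑ᴸ-cong []       f≗g = refl
∑ᴸ-cong (x ∷ xs) f≗g = cong₂ _+_ (f≗g x) (∑ᴸ-cong xs f≗g)

∑ᴸ-++ : ∀ (xs ys : List A) f → ∑ᴸ (xs ++ ys) f ≡ ∑ᴸ xs f + ∑ᴸ ys f
∑ᴸ-++ []       ys f = sym (ℤP.+-identityˡ _)
∑ᴸ-++ (x ∷ xs) ys f = trans (cong (_+_ (f x)) (∑ᴸ-++ xs ys f)) (sym (ℤP.+-assoc (f x) _ _))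

∑ᴸ-map : ∀ (h : B → A) xs f → ∑ᴸ (List.map h xs) f ≡ ∑ᴸ xs (f ∘ h)
∑ᴸ-map h []       f = refl
∑ᴸ-map h (x ∷ xs) f = cong (_+_ (f (h x))) (∑ᴸ-map h xs f)

∑ᴸ-concatMap : ∀ (h : B → List A) xs f →
               ∑ᴸ (concatMap h xs) f ≡ ∑[ x ∈ xs ] ∑ᴸ (h x) f
∑ᴸ-concatMap h []       f = refl
∑ᴸ-concatMap h (x ∷ xs) f =
  trans (∑ᴸ-++ (h x) (concatMap h xs) f) (cong (_+_ (∑ᴸ (h x) f)) (∑ᴸ-concatMap h xs f))

∑ᴸ-distrib-+ : ∀ (xs : List A) f g → ∑[ x ∈ xs ] (f x + g x) ≡ ∑ᴸ xs f + ∑ᴸ xs g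
∑ᴸ-distrib-+ []       f g = refl
∑ᴸ-distrib-+ (x ∷ xs) f g =
  trans (cong (_+_ (f x + g x)) (∑ᴸ-distrib-+ xs f g)) (middle-swap (f x) (g x) _ _)
  where
  middle-swap : ∀ a b c d → a + b + (c + d) ≡ a + c + (b + d)
  middle-swap = solve-∀

*-distribˡ-∑ᴸ : ∀ c (xs : List A) f → c * ∑ᴸ xs f ≡ ∑[ x ∈ xs ] (c * f x)
*-distribˡ-∑ᴸ c []       f = ℤP.*-zeroʳ c
*-distribˡ-∑ᴸ c (x ∷ xs) f =
  trans (ℤP.*-distribˡ-+ c (f x) _) (cong (_+_ (c * f x)) (*-distribˡ-∑ᴸ c xs f))

*-distribʳ-∑ᴸ : ∀ c (xs : List A) f → ∑ᴸ xs f * c ≡ ∑[ x ∈ xs ] (f x * c)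
*-distribʳ-∑ᴸ c xs f = trans (ℤP.*-comm _ c)
  (trans (*-distribˡ-∑ᴸ c xs f) (∑ᴸ-cong xs (λ x → ℤP.*-comm c (f x))))

∑ᴸ-zero : ∀ (xs : List A) {f} → (∀ x → f x ≡ 0ℤ) → ∑ᴸ xs f ≡ 0ℤ
∑ᴸ-zero []       f≡0 = refl
∑ᴸ-zero (x ∷ xs) f≡0 = cong₂ _+_ (f≡0 x) (∑ᴸ-zero xs f≡0)

∑ᴸ-comm : ∀ (xs : List A) (ys : List B) (h : A → B → ℤ) →
          ∑[ x ∈ xs ] ∑[ y ∈ ys ] h x y ≡ ∑[ y ∈ ys ] ∑[ x ∈ xs ] h x y
∑ᴸ-comm []       ys h = sym (∑ᴸ-zero ys (λ _ → refl))
∑ᴸ-comm (x ∷ xs) ys h = trans (cong (_+_ (∑ᴸ ys (h x))) (∑ᴸ-comm xs ys h))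
  (sym (∑ᴸ-distrib-+ ys (h x) (λ y → ∑[ x ∈ xs ] h x y)))

∑ᴸ-mono-≤ : ∀ (xs : List A) {f g} → (∀ x → f x ℤ.≤ g x) → ∑ᴸ xs f ℤ.≤ ∑ᴸ xs g
∑ᴸ-mono-≤ []       f≤g = ℤP.≤-refl
∑ᴸ-mono-≤ (x ∷ xs) f≤g = ℤP.+-mono-≤ (f≤g x) (∑ᴸ-mono-≤ xs f≤g)

∑ᴸ-nonneg : ∀ (xs : List A) {f} → (∀ x → 0ℤ ℤ.≤ f x) → 0ℤ ℤ.≤ ∑ᴸ xs f
∑ᴸ-nonneg xs {f} 0≤f = subst (ℤ._≤ ∑ᴸ xs f) (∑ᴸ-zero xs (λ _ → refl)) (∑ᴸ-mono-≤ xs 0≤f)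

∑ᴸ-tabulate : ∀ {n} (g : Fin n → A) f → ∑ᴸ (List.tabulate g) f ≡ ∑[ i < n ] f (g i)
∑ᴸ-tabulate {n = zero}  g f = refl
∑ᴸ-tabulate {n = suc n} g f = cong (_+_ (f (g zero))) (∑ᴸ-tabulate (g ∘ suc) f)

sum-single : ∀ {n} (f : Fin n → ℤ) i → (∀ j → j ≢ i → f j ≡ 0ℤ) → sum f ≡ f i
sum-single {suc n} f i f≡0 = begin
  sum f                                 ≡⟨ sum-remove {i = i} f ⟩
  f i + sum (λ j → f (Fin.punchIn i j)) ≡⟨ cong (_+_ (f i)) rest≡0 ⟩
  f i + 0ℤ                              ≡⟨ ℤP.+-identityʳ (f i) ⟩
  f i                                   ∎
  where
  open ≡-Reasoning
  rest≡0 : sum (λ j → f (Fin.punchIn i j)) ≡ 0ℤ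
  rest≡0 = trans (sum-cong-≗ (λ j → f≡0 _ (FinP.punchInᵢ≢i i j))) (sum-replicate-zero n)

sum-split : ∀ x y (f : ℕ → ℤ) →
            ∑[ i < x ℕ.+ y ] f (toℕ i) ≡ ∑[ i < x ] f (toℕ i) + ∑[ i < y ] f (x ℕ.+ toℕ i)
sum-split zero    y f = sym (ℤP.+-identityˡ _)
sum-split (suc x) y f = trans (cong (_+_ (f 0)) (sum-split x y (f ∘ suc))) (sym (ℤP.+-assoc (f 0) _ _))

sum-distrib-- : ∀ {n} (f g : Fin n → ℤ) → sum (λ i → f i - g i) ≡ sum f - sum g
sum-distrib-- f g = begin
  sum (λ i → f i - g i)        ≡⟨ sum-cong-≗ (λ i → as-sum (f i) (g i)) ⟩
  sum (λ i → f i + -1ℤ * g i)  ≡⟨ ∑-distrib-+ f (λ i → -1ℤ * g i) ⟩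
  sum f + sum (λ i → -1ℤ * g i) ≡⟨ cong (_+_ (sum f)) (*-distribˡ-sum -1ℤ g) ⟨
  sum f + -1ℤ * sum g          ≡⟨ as-sum (sum f) (sum g) ⟨
  sum f - sum g                ∎
  where
  open ≡-Reasoning
  as-sum : ∀ a b → a - b ≡ a + -1ℤ * b
  as-sum = solve-∀

∣-sum : ∀ {p d} (f : Fin p → ℤ) → (∀ i → d ∣ℤ f i) → d ∣ℤ sum f
∣-sum {zero}  f d∣f = ℤ∣.divides 0ℤ refl
∣-sum {suc p} f d∣f = ℤ∣.∣m∣n⇒∣m+n (d∣f zero) (∣-sum (f ∘ suc) (d∣f ∘ suc))

does-all? : ∀ {k p} {P : Fin (suc k) → Set p} (P? : ∀ i → Dec (P i)) →
            does (FinP.all? P?) ≡ does (P? zero) ∧ does (FinP.all? (P? ∘ suc))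
does-all? P? = does-⇔ (mk⇔ (λ ∀P → ∀P zero , ∀P ∘ suc) (uncurry FinP.∀-cons))
                      (FinP.all? P?) (P? zero ×-dec FinP.all? (P? ∘ suc))

does-all?-lookup : ∀ {n p} {P : Fin n → Set p} (xs : List (Fin n)) (P? : ∀ j → Dec (P j)) →
                   does (FinP.all? (λ c → P? (List.lookup xs c))) ≡ all (does ∘ P?) xs
does-all?-lookup []       P? = refl
does-all?-lookup (x ∷ xs) P? = trans (does-all? (λ c → P? (List.lookup (x ∷ xs) c)))
                                     (cong (does (P? x) ∧_) (does-all?-lookup xs P?))

EachOnce : {X : Set a} → DecidableEquality X → List X → Set a
EachOnce _≟_ xs = ∀ z → ∑[ x ∈ xs ] 𝟙 (does (x ≟ z)) ≡ 1ℤ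

module Enumeration {X : Set a} (_≟_ : DecidableEquality X) (xs : List X)
                   (each-once : EachOnce _≟_ xs) where

  ∑ᴸ-δ : ∀ z (w : X → ℤ) → ∑[ x ∈ xs ] (𝟙 (does (x ≟ z)) * w x) ≡ w z
  ∑ᴸ-δ z w = begin
    ∑[ x ∈ xs ] (𝟙 (does (x ≟ z)) * w x) ≡⟨ ∑ᴸ-cong xs at-z ⟩
    ∑[ x ∈ xs ] (𝟙 (does (x ≟ z)) * w z) ≡⟨ *-distribʳ-∑ᴸ (w z) xs _ ⟨
    ∑[ x ∈ xs ] 𝟙 (does (x ≟ z)) * w z   ≡⟨ cong (_* w z) (each-once z) ⟩
    1ℤ * w z                             ≡⟨ ℤP.*-identityˡ (w z) ⟩
    w z                                  ∎
    where
    open ≡-Reasoning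
    at-z : ∀ x → 𝟙 (does (x ≟ z)) * w x ≡ 𝟙 (does (x ≟ z)) * w z
    at-z x with x ≟ z
    ... | yes refl = refl
    ... | no _     = refl

  ∑ᴸ-bijection : ∀ (φ ψ : X → X) → (∀ x → ψ (φ x) ≡ x) → (∀ y → φ (ψ y) ≡ y) →
                 ∀ (w : X → ℤ) → ∑[ x ∈ xs ] w (φ x) ≡ ∑ᴸ xs w
  ∑ᴸ-bijection φ ψ ψ∘φ φ∘ψ w = begin
    ∑[ x ∈ xs ] w (φ x)
      ≡⟨ ∑ᴸ-cong xs (λ x → ∑ᴸ-δ (φ x) w) ⟨
    ∑[ x ∈ xs ] ∑[ y ∈ xs ] (𝟙 (does (y ≟ φ x)) * w y)
      ≡⟨ ∑ᴸ-comm xs xs _ ⟩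
    ∑[ y ∈ xs ] ∑[ x ∈ xs ] (𝟙 (does (y ≟ φ x)) * w y)
      ≡⟨ ∑ᴸ-cong xs (λ y → ∑ᴸ-cong xs (λ x → cong (λ b → 𝟙 b * w y) (inverse x y))) ⟩
    ∑[ y ∈ xs ] ∑[ x ∈ xs ] (𝟙 (does (x ≟ ψ y)) * w y)
      ≡⟨ ∑ᴸ-cong xs (λ y → ∑ᴸ-δ (ψ y) (λ _ → w y)) ⟩
    ∑ᴸ xs w
      ∎
    where
    open ≡-Reasoning
    inverse : ∀ x y → does (y ≟ φ x) ≡ does (x ≟ ψ y)
    inverse x y = does-⇔
      (mk⇔ (λ y≡φx → trans (sym (ψ∘φ x)) (cong ψ (sym y≡φx)))
           (λ x≡ψy → trans (sym (φ∘ψ y)) (cong φ (sym x≡ψy))))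
      (y ≟ φ x) (x ≟ ψ y)

  ∑ᴸ-nonneg-≡0 : ∀ {f : X → ℤ} → (∀ x → 0ℤ ℤ.≤ f x) → ∑ᴸ xs f ≡ 0ℤ → ∀ z → f z ≡ 0ℤ
  ∑ᴸ-nonneg-≡0 {f} 0≤f ∑f≡0 z = ℤP.≤-antisym fz≤0 (0≤f z)
    where
    fz≤0 : f z ℤ.≤ 0ℤ
    fz≤0 = ℤP.≤-trans (ℤP.≤-reflexive (sym (∑ᴸ-δ z f)))
             (ℤP.≤-trans (∑ᴸ-mono-≤ xs (λ x → 𝟙*-≤ (does (x ≟ z)) (0≤f x))) (ℤP.≤-reflexive ∑f≡0))

vectors : List A → ∀ k → List (Vec A k)
vectors xs zero    = [] ∷ []
vectors xs (suc k) = concatMap (λ x → List.map (x ∷_) (vectors xs k)) xs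

∑ᴸ-vectors-suc : ∀ (xs : List A) k (g : A → ℤ) (h : Vec A k → ℤ) →
                 ∑[ y ∈ vectors xs (suc k) ] (g (Vec.head y) * h (Vec.tail y))
                   ≡ ∑ᴸ xs g * ∑ᴸ (vectors xs k) h
∑ᴸ-vectors-suc xs k g h = begin
  ∑[ y ∈ vectors xs (suc k) ] (g (Vec.head y) * h (Vec.tail y))
    ≡⟨ ∑ᴸ-concatMap _ xs _ ⟩
  ∑[ x ∈ xs ] ∑ᴸ (List.map (x ∷_) (vectors xs k)) (λ y → g (Vec.head y) * h (Vec.tail y))
    ≡⟨ ∑ᴸ-cong xs (λ x → trans (∑ᴸ-map (x ∷_) (vectors xs k) _)
                               (sym (*-distribˡ-∑ᴸ (g x) (vectors xs k) h))) ⟩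
  ∑[ x ∈ xs ] (g x * ∑ᴸ (vectors xs k) h)
    ≡⟨ *-distribʳ-∑ᴸ _ xs g ⟨
  ∑ᴸ xs g * ∑ᴸ (vectors xs k) h
    ∎
  where open ≡-Reasoning

vectors-each-once : ∀ {_≟_ : DecidableEquality A} {xs} → EachOnce _≟_ xs →
                    ∀ k → EachOnce (VecP.≡-dec _≟_) (vectors xs k)
vectors-each-once once zero    []       = refl
vectors-each-once {_≟_ = _≟_} {xs} once (suc k) (z ∷ zs) = begin
  ∑[ y ∈ vectors xs (suc k) ] 𝟙 (does (VecP.≡-dec _≟_ y (z ∷ zs)))
    ≡⟨ ∑ᴸ-cong (vectors xs (suc k)) split ⟩
  ∑[ y ∈ vectors xs (suc k) ] (𝟙 (does (Vec.head y ≟ z)) * 𝟙 (does (VecP.≡-dec _≟_ (Vec.tail y) zs)))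
    ≡⟨ ∑ᴸ-vectors-suc xs k (λ x → 𝟙 (does (x ≟ z))) (λ y → 𝟙 (does (VecP.≡-dec _≟_ y zs))) ⟩
  ∑[ x ∈ xs ] 𝟙 (does (x ≟ z)) * ∑[ y ∈ vectors xs k ] 𝟙 (does (VecP.≡-dec _≟_ y zs))
    ≡⟨ cong₂ _*_ (once z) (vectors-each-once once k zs) ⟩
  1ℤ
    ∎
  where
  open ≡-Reasoning
  split : ∀ y → 𝟙 (does (VecP.≡-dec _≟_ y (z ∷ zs)))
                ≡ 𝟙 (does (Vec.head y ≟ z)) * 𝟙 (does (VecP.≡-dec _≟_ (Vec.tail y) zs))
  split (x ∷ y) = 𝟙-∧ (does (x ≟ z)) (does (VecP.≡-dec _≟_ y zs))

allFin-each-once : ∀ q → EachOnce Fin._≟_ (List.allFin q)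
allFin-each-once q z = begin
  ∑[ x ∈ List.allFin q ] 𝟙 (does (x Fin.≟ z))
    ≡⟨ ∑ᴸ-tabulate (λ i → i) (λ x → 𝟙 (does (x Fin.≟ z))) ⟩
  ∑[ x < q ] 𝟙 (does (x Fin.≟ z))
    ≡⟨ sum-single (λ x → 𝟙 (does (x Fin.≟ z))) z (λ x x≢z → cong 𝟙 (dec-false (x Fin.≟ z) x≢z)) ⟩
  𝟙 (does (z Fin.≟ z))
    ≡⟨ cong 𝟙 (dec-true (z Fin.≟ z) refl) ⟩
  1ℤ
    ∎
  where open ≡-Reasoning

_≟ˢ_ : ∀ {n} → DecidableEquality (Subset n)
_≟ˢ_ = VecP.≡-dec Bool._≟_

subsets≡vectors : ∀ n → subsets n ≡ vectors (outside ∷ inside ∷ []) n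
subsets≡vectors zero    = refl
subsets≡vectors (suc n) rewrite subsets≡vectors n =
  cong (List.map (outside ∷_) V ++_) (sym (ListP.++-identityʳ (List.map (inside ∷_) V)))
  where V = vectors (outside ∷ inside ∷ []) n

subsets-each-once : ∀ n → EachOnce _≟ˢ_ (subsets n)
subsets-each-once n = subst (EachOnce _≟ˢ_) (sym (subsets≡vectors n))
  (vectors-each-once {_≟_ = Bool._≟_} bool-each-once n)
  where
  bool-each-once : EachOnce Bool._≟_ (outside ∷ inside ∷ [])
  bool-each-once false = refl
  bool-each-once true  = refl

full≡⊤ : ∀ {n} → full {n} ≡ ⊤
full≡⊤ {zero}  = refl
full≡⊤ {suc n} = cong (inside ∷_) full≡⊤

⊆-full : ∀ {n} (K : Subset n) → K ⊆ full
⊆-full K = subst (K ⊆_) (sym full≡⊤) SubsetP.⊆⊤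

∣full∣≡n : ∀ {n} → ∣ full {n} ∣ ≡ n
∣full∣≡n {n} = trans (cong ∣_∣ (full≡⊤ {n})) (SubsetP.∣⊤∣≡n n)

⊆-≢⇒∣∣< : ∀ {n} {J L : Subset n} → J ⊆ L → J ≢ L → ∣ J ∣ ℕ.< ∣ L ∣
⊆-≢⇒∣∣< {J = []}          {[]}          _   J≢L = contradiction refl J≢L
⊆-≢⇒∣∣< {J = outside ∷ J} {outside ∷ L} J⊆L J≢L =
  ⊆-≢⇒∣∣< (SubsetP.drop-∷-⊆ J⊆L) (J≢L ∘ cong (outside ∷_))
⊆-≢⇒∣∣< {J = inside ∷ J}  {inside ∷ L}  J⊆L J≢L =
  ℕ.s≤s (⊆-≢⇒∣∣< (SubsetP.drop-∷-⊆ J⊆L) (J≢L ∘ cong (inside ∷_)))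
⊆-≢⇒∣∣< {J = outside ∷ J} {inside ∷ L}  J⊆L _   = ℕ.s≤s (SubsetP.p⊆q⇒∣p∣≤∣q∣ (SubsetP.drop-∷-⊆ J⊆L))
⊆-≢⇒∣∣< {J = inside ∷ J}  {outside ∷ L} J⊆L _   with () ← J⊆L Vec.here

≢full⇒∣∣< : ∀ {n} {L : Subset n} → L ≢ full → ∣ L ∣ ℕ.< n
≢full⇒∣∣< {n} {L} L≢full =
  ℕP.≤∧≢⇒< (SubsetP.∣p∣≤n L) (λ ∣L∣≡n → L≢full (trans (SubsetP.∣p∣≡n⇒p≡⊤ ∣L∣≡n) (sym full≡⊤)))

∈-subsets : ∀ n (J : Subset n) → J ∈ᴸ subsets n
∈-subsets zero    []            = here refl
∈-subsets (suc n) (outside ∷ J) = ∈-++⁺ˡ (∈-map⁺ (outside ∷_) (∈-subsets n J))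
∈-subsets (suc n) (inside ∷ J)  =
  ∈-++⁺ʳ (List.map (outside ∷_) (subsets n)) (∈-map⁺ (inside ∷_) (∈-subsets n J))

length-elems : ∀ {n} (K : Subset n) → List.length (elems K) ≡ ∣ K ∣
length-elems []            = refl
length-elems (inside ∷ K)  = cong suc (trans (ListP.length-map suc (elems K)) (length-elems K))
length-elems (outside ∷ K) = trans (ListP.length-map suc (elems K)) (length-elems K)

all-map : ∀ (b : B → Bool) (f : A → B) xs → all b (List.map f xs) ≡ all (b ∘ f) xs
all-map b f xs = cong and (sym (ListP.map-∘ xs))

does-⊆? : ∀ {n} (K S : Subset n) → does (K ⊆? S) ≡ all (Vec.lookup S) (elems K)
does-⊆? []            []            = refl
does-⊆? (outside ∷ K) (x ∷ S)       = trans (does-⊆? K S) (sym (all-map (Vec.lookup (x ∷ S)) suc (elems K)))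
does-⊆? (inside ∷ K)  (inside ∷ S)  = trans (does-⊆? K S) (sym (all-map (Vec.lookup (inside ∷ S)) suc (elems K)))
does-⊆? (inside ∷ K)  (outside ∷ S) = refl

alternating : ∀ {n} → Subset n → Subset n → Subset n → ℤ
alternating J S L = 𝟙 (does (J ⊆? L)) * (-1ℤ ^ (∣ L ∣ ∸ ∣ J ∣) * 𝟙 (does (L ⊆? S)))

alternating-flip : ∀ {n} (J S L : Subset n) →
                   alternating (outside ∷ J) (inside ∷ S) (inside ∷ L) ≡ -1ℤ * alternating J S L
alternating-flip J S L with J ⊆? L
... | no _    = refl
... | yes J⊆L = trans (cong (λ e → 1ℤ * (-1ℤ ^ e * 𝟙 (does (L ⊆? S))))
                            (ℕP.+-∸-assoc 1 (SubsetP.p⊆q⇒∣p∣≤∣q∣ J⊆L)))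
                      (sign-step (-1ℤ ^ (∣ L ∣ ∸ ∣ J ∣)) (𝟙 (does (L ⊆? S))))
  where
  sign-step : ∀ s x → 1ℤ * ((-1ℤ * s) * x) ≡ -1ℤ * (1ℤ * (s * x))
  sign-step = solve-∀

∑-alternating : ∀ n (J S : Subset n) → ∑[ L ∈ subsets n ] alternating J S L ≡ 𝟙 (does (J ≟ˢ S))
∑-alternating zero    []      []      = refl
∑-alternating (suc n) (a ∷ J) (b ∷ S) = begin
  ∑ᴸ (subsets (suc n)) T
    ≡⟨ ∑ᴸ-++ (List.map (outside ∷_) (subsets n)) (List.map (inside ∷_) (subsets n)) T ⟩
  ∑ᴸ (List.map (outside ∷_) (subsets n)) T + ∑ᴸ (List.map (inside ∷_) (subsets n)) T
    ≡⟨ cong₂ _+_ (∑ᴸ-map (outside ∷_) (subsets n) T) (∑ᴸ-map (inside ∷_) (subsets n) T) ⟩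
  ∑[ L ∈ subsets n ] T (outside ∷ L) + ∑[ L ∈ subsets n ] T (inside ∷ L)
    ≡⟨ by-cases a b ⟩
  𝟙 (does ((a ∷ J) ≟ˢ (b ∷ S)))
    ∎
  where
  open ≡-Reasoning
  T = alternating (a ∷ J) (b ∷ S)
  IH = ∑-alternating n J S
  *-zeroʳʳ : ∀ x y → x * (y * 0ℤ) ≡ 0ℤ
  *-zeroʳʳ x y = trans (cong (x *_) (ℤP.*-zeroʳ y)) (ℤP.*-zeroʳ x)
  ∑0 : ∀ {f : Subset n → ℤ} → (∀ L → f L ≡ 0ℤ) → ∑ᴸ (subsets n) f ≡ 0ℤ
  ∑0 = ∑ᴸ-zero (subsets n)
  by-cases : ∀ a b →
    ∑[ L ∈ subsets n ] alternating (a ∷ J) (b ∷ S) (outside ∷ L)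
      + ∑[ L ∈ subsets n ] alternating (a ∷ J) (b ∷ S) (inside ∷ L)
      ≡ 𝟙 (does ((a ∷ J) ≟ˢ (b ∷ S)))
  by-cases true  true  = trans (cong₂ _+_ (∑0 (λ _ → refl)) IH) (ℤP.+-identityˡ _)
  by-cases true  false = cong₂ _+_ (∑0 (λ _ → refl))
                                   (∑0 (λ L → *-zeroʳʳ (𝟙 (does (J ⊆? L))) (-1ℤ ^ (∣ L ∣ ∸ ∣ J ∣))))
  by-cases false false =
    trans (cong₂ _+_ IH (∑0 (λ L → *-zeroʳʳ (𝟙 (does (J ⊆? L))) (-1ℤ ^ (suc ∣ L ∣ ∸ ∣ J ∣)))))
          (ℤP.+-identityʳ _)
  by-cases false true  = begin
    ∑[ L ∈ subsets n ] alternating J S L + ∑[ L ∈ subsets n ] alternating (outside ∷ J) (inside ∷ S) (inside ∷ L)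
      ≡⟨ cong (_+_ (∑[ L ∈ subsets n ] alternating J S L))
              (trans (∑ᴸ-cong (subsets n) (alternating-flip J S))
                     (sym (*-distribˡ-∑ᴸ -1ℤ (subsets n) (alternating J S)))) ⟩
    ∑[ L ∈ subsets n ] alternating J S L + -1ℤ * ∑[ L ∈ subsets n ] alternating J S L
      ≡⟨ cong (λ x → x + -1ℤ * x) IH ⟩
    𝟙 (does (J ≟ˢ S)) + -1ℤ * 𝟙 (does (J ≟ˢ S))
      ≡⟨ cancel (𝟙 (does (J ≟ˢ S))) ⟩
    0ℤ
      ∎
    where
    cancel : ∀ x → x + -1ℤ * x ≡ 0ℤ
    cancel = solve-∀

module SubsetCounts {X : Set a} (xs : List X) {n} (S : X → Subset n) where
  open Enumeration _≟ˢ_ (subsets n) (subsets-each-once n)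

  atLeast : Subset n → ℤ
  atLeast K = ∑[ x ∈ xs ] 𝟙 (does (K ⊆? S x))

  exactly : Subset n → ℤ
  exactly J = ∑[ x ∈ xs ] 𝟙 (does (J ≟ˢ S x))

  atLeast≡∑exactly : ∀ J → atLeast J ≡ ∑[ L ∈ subsets n ] (𝟙 (does (J ⊆? L)) * exactly L)
  atLeast≡∑exactly J = begin
    ∑[ x ∈ xs ] 𝟙 (does (J ⊆? S x))
      ≡⟨ ∑ᴸ-cong xs (λ x → ∑ᴸ-δ (S x) (λ L → 𝟙 (does (J ⊆? L)))) ⟨
    ∑[ x ∈ xs ] ∑[ L ∈ subsets n ] (𝟙 (does (L ≟ˢ S x)) * 𝟙 (does (J ⊆? L)))
      ≡⟨ ∑ᴸ-comm xs (subsets n) _ ⟩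
    ∑[ L ∈ subsets n ] ∑[ x ∈ xs ] (𝟙 (does (L ≟ˢ S x)) * 𝟙 (does (J ⊆? L)))
      ≡⟨ ∑ᴸ-cong (subsets n) (λ L → trans (sym (*-distribʳ-∑ᴸ (𝟙 (does (J ⊆? L))) xs
                                                                (λ x → 𝟙 (does (L ≟ˢ S x)))))
                                          (ℤP.*-comm (exactly L) _)) ⟩
    ∑[ L ∈ subsets n ] (𝟙 (does (J ⊆? L)) * exactly L)
      ∎
    where open ≡-Reasoning

  exactly≡∑atLeast : ∀ J →
    exactly J ≡ ∑[ L ∈ subsets n ] (𝟙 (does (J ⊆? L)) * (-1ℤ ^ (∣ L ∣ ∸ ∣ J ∣) * atLeast L))
  exactly≡∑atLeast J = begin
    ∑[ x ∈ xs ] 𝟙 (does (J ≟ˢ S x))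
      ≡⟨ ∑ᴸ-cong xs (λ x → ∑-alternating n J (S x)) ⟨
    ∑[ x ∈ xs ] ∑[ L ∈ subsets n ] alternating J (S x) L
      ≡⟨ ∑ᴸ-comm xs (subsets n) _ ⟩
    ∑[ L ∈ subsets n ] ∑[ x ∈ xs ] alternating J (S x) L
      ≡⟨ ∑ᴸ-cong (subsets n) (λ L → sym (expand L)) ⟩
    ∑[ L ∈ subsets n ] (𝟙 (does (J ⊆? L)) * (-1ℤ ^ (∣ L ∣ ∸ ∣ J ∣) * atLeast L))
      ∎
    where
    open ≡-Reasoning
    expand : ∀ L → 𝟙 (does (J ⊆? L)) * (-1ℤ ^ (∣ L ∣ ∸ ∣ J ∣) * atLeast L)
                   ≡ ∑[ x ∈ xs ] alternating J (S x) L
    expand L = trans (cong (𝟙 (does (J ⊆? L)) *_) (*-distribˡ-∑ᴸ sign xs (λ x → 𝟙 (does (L ⊆? S x)))))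
                     (*-distribˡ-∑ᴸ (𝟙 (does (J ⊆? L))) xs (λ x → sign * 𝟙 (does (L ⊆? S x))))
      where sign = -1ℤ ^ (∣ L ∣ ∸ ∣ J ∣)

  exactly-nonneg : ∀ J → 0ℤ ℤ.≤ exactly J
  exactly-nonneg J = ∑ᴸ-nonneg xs (λ x → 𝟙-nonneg _)

  exactly-full : exactly full ≡ atLeast full
  exactly-full = ∑ᴸ-cong xs (λ x → cong 𝟙 (does-⇔ full≡⇔full⊆ (full ≟ˢ S x) (full ⊆? S x)))
    where
    full≡⇔full⊆ : ∀ {T} → full ≡ T ⇔ full ⊆ T
    full≡⇔full⊆ {T} = mk⇔ SubsetP.⊆-reflexive (λ full⊆T → SubsetP.⊆-antisym full⊆T (⊆-full T))

  atLeast-full-≤ : ∀ K → atLeast full ℤ.≤ atLeast K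
  atLeast-full-≤ K = ∑ᴸ-mono-≤ xs (λ x → 𝟙-mono (SubsetP.⊆-trans (⊆-full K)) (full ⊆? S x) (K ⊆? S x))

does-∣ℤ? : ∀ m n → does (+ m ∣ℤ? + n) ≡ does (m ∣? n)
does-∣ℤ? m n = does-⇔ (mk⇔ ℤ∣.∣⇒∣ᵤ ℤ∣.∣ᵤ⇒∣) (+ m ∣ℤ? + n) (m ∣? n)

count-multiples : ∀ g q′ .{{_ : NonZero q′}} → ∑[ a < g ℕ.* q′ ] 𝟙 (does (q′ ∣? toℕ a)) ≡ + g
count-multiples zero    q′ = refl
count-multiples (suc g) q′@(suc q″) = begin
  ∑[ a < q′ ℕ.+ g ℕ.* q′ ] 𝟙 (does (q′ ∣? toℕ a))
    ≡⟨ sum-split q′ (g ℕ.* q′) (λ a → 𝟙 (does (q′ ∣? a))) ⟩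
  ∑[ a < q′ ] 𝟙 (does (q′ ∣? toℕ a)) + ∑[ a < g ℕ.* q′ ] 𝟙 (does (q′ ∣? q′ ℕ.+ toℕ a))
    ≡⟨ cong₂ _+_ first-period
                 (trans (sum-cong-≗ {g ℕ.* q′} (λ a → cong 𝟙 (shift (toℕ a)))) (count-multiples g q′)) ⟩
  1ℤ + + g
    ∎
  where
  open ≡-Reasoning
  shift : ∀ a → does (q′ ∣? q′ ℕ.+ a) ≡ does (q′ ∣? a)
  shift a = does-⇔ (mk⇔ (λ d → ℕ∣.∣m+n∣m⇒∣n d ℕ∣.∣-refl) (ℕ∣.∣m∣n⇒∣m+n ℕ∣.∣-refl))
                   (q′ ∣? q′ ℕ.+ a) (q′ ∣? a)
  first-period : ∑[ a < q′ ] 𝟙 (does (q′ ∣? toℕ a)) ≡ 1ℤ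
  first-period = trans (sum-single _ zero (λ a a≢0 → cong 𝟙 (dec-false (q′ ∣? toℕ a) (non-multiple a a≢0))))
                       (cong 𝟙 (dec-true (q′ ∣? 0) (q′ ℕ∣.∣0)))
    where
    non-multiple : ∀ (a : Fin q′) → a ≢ zero → ¬ (q′ ∣ toℕ a)
    non-multiple zero    a≢0 = contradiction refl a≢0
    non-multiple (suc a) _   = ℕ∣.>⇒∤ (FinP.toℕ<n (suc a))

-- With g = gcd q e: q ∣ a·e iff q/g ∣ a, and [0, q) holds g multiples of q/g.
count-gcd : ∀ q e .{{_ : NonZero q}} → ∑[ a < q ] 𝟙 (does (q ∣? toℕ a ℕ.* e)) ≡ + gcd q e
count-gcd q e = begin
  ∑[ a < q ] 𝟙 (does (q ∣? toℕ a ℕ.* e))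
    ≡⟨ sum-cong-≗ {q} (λ a → cong 𝟙 (does-⇔ multiple-of-q′ (q ∣? toℕ a ℕ.* e) (q′ ∣? toℕ a))) ⟩
  ∑[ a < q ] 𝟙 (does (q′ ∣? toℕ a))
    ≡⟨ cong (λ r → ∑[ a < r ] 𝟙 (does (q′ ∣? toℕ a))) q≡g*q′ ⟩
  ∑[ a < g ℕ.* q′ ] 𝟙 (does (q′ ∣? toℕ a))
    ≡⟨ count-multiples g q′ ⟩
  + g
    ∎
  where
  open ≡-Reasoning
  g = gcd q e
  instance
    g≢0 : NonZero g
    g≢0 = ℕ.≢-nonZero (gcd[m,n]≢0 q e (inj₁ (ℕ.≢-nonZero⁻¹ q)))
  q′ = q ℕ./ g
  e′ = e ℕ./ g
  q≡q′*g : q ≡ q′ ℕ.* g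
  q≡q′*g = sym (m/n*n≡m (gcd[m,n]∣m q e))
  e≡e′*g : e ≡ e′ ℕ.* g
  e≡e′*g = sym (m/n*n≡m (gcd[m,n]∣n q e))
  q≡g*q′ : q ≡ g ℕ.* q′
  q≡g*q′ = trans q≡q′*g (ℕP.*-comm q′ g)
  instance
    q′≢0 : NonZero q′
    q′≢0 = ℕ.≢-nonZero (λ q′≡0 → ℕ.≢-nonZero⁻¹ q (trans q≡q′*g (cong (ℕ._* g) q′≡0)))
  multiple-of-q′ : ∀ {a} → (q ∣ a ℕ.* e) ⇔ (q′ ∣ a)
  multiple-of-q′ {a} = mk⇔
    (λ q∣ae → coprime-divisor (coprime-/gcd q e)
       (subst (q′ ∣_) (ℕP.*-comm a e′) (ℕ∣.*-cancelʳ-∣ g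
         (subst₂ _∣_ q≡q′*g (trans (cong (a ℕ.*_) e≡e′*g) (sym (ℕP.*-assoc a e′ g))) q∣ae))))
    (λ q′∣a → subst₂ _∣_ (sym q≡q′*g)
       (trans (ℕP.*-assoc a g e′) (cong (a ℕ.*_) (trans (ℕP.*-comm g e′) (sym e≡e′*g))))
       (ℕ∣.∣m⇒∣m*n e′ (ℕ∣.*-monoˡ-∣ g q′∣a)))

gcd-periodic : ∀ m ρ N e → e ∣ ρ → gcd (m ℕ.+ ρ ℕ.* N) e ≡ gcd m e
gcd-periodic m ρ N e e∣ρ = sym (gcd-universality forwards backwards)
  where
  ∣ρN : ∀ {d} → d ∣ e → d ∣ ρ ℕ.* N
  ∣ρN d∣e = ℕ∣.∣m⇒∣m*n N (ℕ∣.∣-trans d∣e e∣ρ)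
  forwards : ∀ {d} → (d ∣ m ℕ.+ ρ ℕ.* N) × (d ∣ e) → d ∣ gcd m e
  forwards {d} (d∣m+ρN , d∣e) =
    gcd-greatest (ℕ∣.∣m+n∣m⇒∣n (subst (d ∣_) (ℕP.+-comm m (ρ ℕ.* N)) d∣m+ρN) (∣ρN d∣e)) d∣e
  backwards : ∀ {d} → d ∣ gcd m e → (d ∣ m ℕ.+ ρ ℕ.* N) × (d ∣ e)
  backwards d∣g = ℕ∣.∣m∣n⇒∣m+n (ℕ∣.∣-trans d∣g (gcd[m,n]∣m m e)) (∣ρN d∣e) , d∣e
    where d∣e = ℕ∣.∣-trans d∣g (gcd[m,n]∣n m e)

product-gcd-1 : ∀ es → product (List.map (gcd 1) es) ≡ 1
product-gcd-1 []       = refl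
product-gcd-1 (e ∷ es) = cong₂ ℕ._*_ (gcd-zeroˡ e) (product-gcd-1 es)

nth0-≥ : ∀ es l → List.length es ℕ.≤ l → nth0 es l ≡ 0
nth0-≥ []       l       _          = refl
nth0-≥ (e ∷ es) (suc l) (ℕ.s≤s le) = nth0-≥ es l le

product-gcd-nth0 : ∀ q k es → List.length es ℕ.≤ k →
  product (List.tabulate (λ (i : Fin k) → gcd q (nth0 es (toℕ i))))
    ≡ q ℕ.^ (k ∸ List.length es) ℕ.* product (List.map (gcd q) es)
product-gcd-nth0 q zero    []       _          = refl
product-gcd-nth0 q (suc k) []       _          =
  trans (cong₂ ℕ._*_ (gcd-identityʳ q) (product-gcd-nth0 q k [] ℕ.z≤n)) (sym (ℕP.*-assoc q (q ℕ.^ k) 1))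
product-gcd-nth0 q (suc k) (e ∷ es) (ℕ.s≤s le) =
  trans (cong (gcd q e ℕ.*_) (product-gcd-nth0 q k es le))
        (ℕ*.x∙yz≈y∙xz (gcd q e) (q ℕ.^ (k ∸ List.length es)) (product (List.map (gcd q) es)))

sumFin≡sum : ∀ {p} (f : Fin p → ℤ) → sumFin f ≡ sum f
sumFin≡sum {zero}  f = refl
sumFin≡sum {suc p} f = cong (_+_ (f zero)) (sumFin≡sum (f ∘ suc))

infixl 7 _ᵛ*_
_ᵛ*_ : ∀ {k p} → (Fin k → ℤ) → Mat k p → Fin p → ℤ
(v ᵛ* M) j = sum (λ i → v i * M i j)

ᵛ*-cong : ∀ {k p} (v : Fin k → ℤ) {M N : Mat k p} → (∀ i j → M i j ≡ N i j) →
          ∀ j → (v ᵛ* M) j ≡ (v ᵛ* N) j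
ᵛ*-cong v M≡N j = sum-cong-≗ (λ i → cong (v i *_) (M≡N i j))

ᵛ*-assoc : ∀ {k p r} (v : Fin k → ℤ) (A : Mat k p) (B : Mat p r) →
           ∀ j → ((v ᵛ* A) ᵛ* B) j ≡ (v ᵛ* (A ⊛ B)) j
ᵛ*-assoc v A B j = begin
  sum (λ l → sum (λ i → v i * A i l) * B l j)
    ≡⟨ sum-cong-≗ (λ l → *-distribʳ-sum (B l j) (λ i → v i * A i l)) ⟩
  sum (λ l → sum (λ i → v i * A i l * B l j))
    ≡⟨ ∑-comm (λ l i → v i * A i l * B l j) ⟩
  sum (λ i → sum (λ l → v i * A i l * B l j))
    ≡⟨ sum-cong-≗ (λ i → trans (sum-cong-≗ (λ l → ℤP.*-assoc (v i) (A i l) (B l j)))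
                               (sym (*-distribˡ-sum (v i) (λ l → A i l * B l j)))) ⟩
  sum (λ i → v i * sum (λ l → A i l * B l j))
    ≡⟨ sum-cong-≗ (λ i → cong (v i *_) (sym (sumFin≡sum (λ l → A i l * B l j)))) ⟩
  sum (λ i → v i * (A ⊛ B) i j)
    ∎
  where open ≡-Reasoning

ᵛ*-idMat : ∀ {k} (v : Fin k → ℤ) j → (v ᵛ* idMat) j ≡ v j
ᵛ*-idMat v j = begin
  (v ᵛ* idMat) j                                     ≡⟨ sum-single _ j off-diagonal ⟩
  v j * (if does (toℕ j ℕ.≟ toℕ j) then + 1 else + 0) ≡⟨ cong (λ b → v j * (if b then + 1 else + 0))
                                                              (dec-true (toℕ j ℕ.≟ toℕ j) refl) ⟩
  v j * + 1                                          ≡⟨ ℤP.*-identityʳ (v j) ⟩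
  v j                                                ∎
  where
  open ≡-Reasoning
  off-diagonal : ∀ i → i ≢ j → v i * idMat i j ≡ 0ℤ
  off-diagonal i i≢j = trans (cong (λ b → v i * (if b then + 1 else + 0))
                                   (dec-false (toℕ i ℕ.≟ toℕ j) (i≢j ∘ FinP.toℕ-injective)))
                             (ℤP.*-zeroʳ (v i))

ᵛ*-inverse : ∀ {k p} (v : Fin k → ℤ) (A : Mat k p) (A′ : Mat p k) →
             (∀ i j → (A ⊛ A′) i j ≡ idMat i j) → ∀ j → ((v ᵛ* A) ᵛ* A′) j ≡ v j
ᵛ*-inverse v A A′ AA′≡I j = trans (ᵛ*-assoc v A A′ j) (trans (ᵛ*-cong v AA′≡I j) (ᵛ*-idMat v j))

ᵛ*-distrib-- : ∀ {k p} (v w : Fin k → ℤ) (M : Mat k p) j →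
               ((λ i → v i - w i) ᵛ* M) j ≡ (v ᵛ* M) j - (w ᵛ* M) j
ᵛ*-distrib-- v w M j = trans (sum-cong-≗ (λ i → distrib (v i) (w i) (M i j)))
                             (sum-distrib-- (λ i → v i * M i j) (λ i → w i * M i j))
  where
  distrib : ∀ a b c → (a - b) * c ≡ a * c - b * c
  distrib = solve-∀

module Modular (q : ℕ) .{{_ : NonZero q}} where

  -- A record rather than a synonym for divisibility, so that a and b are inferable.
  infix 4 _≡ₘ_
  record _≡ₘ_ (a b : ℤ) : Set where
    constructor mod-q
    field divides-difference : + q ∣ℤ a - b
  open _≡ₘ_

  ≡⇒≡ₘ : ∀ {a b} → a ≡ b → a ≡ₘ b
  ≡⇒≡ₘ {a} refl = mod-q (ℤ∣.divides 0ℤ (ℤP.+-inverseʳ a))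

  ≡ₘ-sym : ∀ {a b} → a ≡ₘ b → b ≡ₘ a
  ≡ₘ-sym {a} {b} (mod-q q∣a-b) = mod-q (subst (+ q ∣ℤ_) (negate a b) (ℤ∣.∣m⇒∣-m q∣a-b))
    where
    negate : ∀ a b → - (a - b) ≡ b - a
    negate = solve-∀

  ≡ₘ-trans : ∀ {a b c} → a ≡ₘ b → b ≡ₘ c → a ≡ₘ c
  ≡ₘ-trans {a} {b} {c} (mod-q q∣a-b) (mod-q q∣b-c) =
    mod-q (subst (+ q ∣ℤ_) (telescope a b c) (ℤ∣.∣m∣n⇒∣m+n q∣a-b q∣b-c))
    where
    telescope : ∀ a b c → (a - b) + (b - c) ≡ a - c
    telescope = solve-∀

  ≡ₘ-∣ : ∀ {a b} → a ≡ₘ b → + q ∣ℤ b → + q ∣ℤ a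
  ≡ₘ-∣ {a} {b} (mod-q q∣a-b) q∣b = subst (+ q ∣ℤ_) (cancel a b) (ℤ∣.∣m∣n⇒∣m+n q∣a-b q∣b)
    where
    cancel : ∀ a b → (a - b) + b ≡ a
    cancel = solve-∀

  ≡ₘ⇒≡-≤ : ∀ {a b} → a ℕ.≤ b → b ℕ.< q → + a ≡ₘ + b → a ≡ b
  ≡ₘ⇒≡-≤ {a} {b} a≤b b<q (mod-q q∣a-b) =
    ℕP.≤-antisym a≤b (ℕP.m∸n≡0⇒m≤n (below-q (b ∸ a) q∣b∸a (ℕP.≤-<-trans (ℕP.m∸n≤m b a) b<q)))
    where
    difference : - (+ a - + b) ≡ + (b ∸ a)
    difference = trans (cong -_ (trans (ℤP.[+m]-[+n]≡m⊖n a b) (ℤP.⊖-≤ a≤b))) (ℤP.neg-involutive _)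
    q∣b∸a : q ∣ b ∸ a
    q∣b∸a = ℤ∣.∣⇒∣ᵤ (subst (+ q ∣ℤ_) difference (ℤ∣.∣m⇒∣-m q∣a-b))
    below-q : ∀ d → q ∣ d → d ℕ.< q → d ≡ 0
    below-q zero    _   _   = refl
    below-q (suc d) q∣d d<q = contradiction q∣d (ℕ∣.>⇒∤ d<q)

  ≡ₘ⇒≡ : ∀ {a b} → a ℕ.< q → b ℕ.< q → + a ≡ₘ + b → a ≡ b
  ≡ₘ⇒≡ {a} {b} a<q b<q a≡b with ℕP.≤-total a b
  ... | inj₁ a≤b = ≡ₘ⇒≡-≤ a≤b b<q a≡b
  ... | inj₂ b≤a = sym (≡ₘ⇒≡-≤ b≤a a<q (≡ₘ-sym a≡b))

  residue : ℤ → Fin q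
  residue z = Fin.fromℕ< (n%ℕd<d z q)

  residue-≡ₘ : ∀ z → + toℕ (residue z) ≡ₘ z
  residue-≡ₘ z = mod-q (ℤ∣.divides (- (z /ℕ q)) (begin
    + toℕ (residue z) - z                        ≡⟨ cong (λ r → + r - z) (FinP.toℕ-fromℕ< (n%ℕd<d z q)) ⟩
    + (z %ℕ q) - z                               ≡⟨ cong (λ w → + (z %ℕ q) - w) (a≡a%ℕn+[a/ℕn]*n z q) ⟩
    + (z %ℕ q) - (+ (z %ℕ q) + (z /ℕ q) * + q)   ≡⟨ remainder-cancels (+ (z %ℕ q)) (z /ℕ q) (+ q) ⟩
    - (z /ℕ q) * + q                             ∎))
    where
    open ≡-Reasoning
    remainder-cancels : ∀ r t d → r - (r + t * d) ≡ - t * d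
    remainder-cancels = solve-∀

  residue-unique : ∀ (r : Fin q) z → + toℕ r ≡ₘ z → residue z ≡ r
  residue-unique r z r≡z = FinP.toℕ-injective
    (≡ₘ⇒≡ (FinP.toℕ<n (residue z)) (FinP.toℕ<n r) (≡ₘ-trans (residue-≡ₘ z) (≡ₘ-sym r≡z)))

  lift : ∀ {k} → Vec (Fin q) k → Fin k → ℤ
  lift x i = + toℕ (Vec.lookup x i)

  reduce : ∀ {k} → (Fin k → ℤ) → Vec (Fin q) k
  reduce v = Vec.tabulate (residue ∘ v)

  lift-reduce : ∀ {k} (v : Fin k → ℤ) i → lift (reduce v) i ≡ₘ v i
  lift-reduce v i =
    subst (λ r → + toℕ r ≡ₘ v i) (sym (VecP.lookup∘tabulate (residue ∘ v) i)) (residue-≡ₘ (v i))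

  reduce-unique : ∀ {k} (v : Fin k → ℤ) x → (∀ i → lift x i ≡ₘ v i) → reduce v ≡ x
  reduce-unique v x x≡v = trans (VecP.tabulate-cong (λ i → residue-unique (Vec.lookup x i) (v i) (x≡v i)))
                                (VecP.tabulate∘lookup x)

  ∣-ᵛ* : ∀ {k p} {v : Fin k → ℤ} (M : Mat k p) → (∀ i → + q ∣ℤ v i) → ∀ j → + q ∣ℤ (v ᵛ* M) j
  ∣-ᵛ* {v = v} M q∣v j = ∣-sum (λ i → v i * M i j) (λ i → ℤ∣.∣m⇒∣m*n (M i j) (q∣v i))

  ᵛ*-resp-≡ₘ : ∀ {k p} {v w : Fin k → ℤ} (M : Mat k p) → (∀ i → v i ≡ₘ w i) →
               ∀ j → (v ᵛ* M) j ≡ₘ (w ᵛ* M) j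
  ᵛ*-resp-≡ₘ {v = v} {w} M v≡w j =
    mod-q (subst (+ q ∣ℤ_) (ᵛ*-distrib-- v w M j) (∣-ᵛ* M (divides-difference ∘ v≡w) j))

  points : ∀ k → List (Vec (Fin q) k)
  points = vectors (List.allFin q)

  InKernel : ∀ {k p} → Mat k p → Vec (Fin q) k → Set
  InKernel M x = ∀ j → + q ∣ℤ (lift x ᵛ* M) j

  inKernel? : ∀ {k p} (M : Mat k p) x → Dec (InKernel M x)
  inKernel? M x = FinP.all? (λ j → + q ∣ℤ? (lift x ᵛ* M) j)

  kernelSize : ∀ {k p} → Mat k p → ℤ
  kernelSize {k} M = ∑[ x ∈ points k ] 𝟙 (does (inKernel? M x))

  kernelSize-cong : ∀ {k p} {M N : Mat k p} → (∀ i j → M i j ≡ N i j) → kernelSize M ≡ kernelSize N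
  kernelSize-cong {k} {M = M} {N} M≡N = ∑ᴸ-cong (points k) (λ x → cong 𝟙 (does-⇔
    (mk⇔ (λ h j → subst (+ q ∣ℤ_) (ᵛ*-cong (lift x) M≡N j) (h j))
         (λ h j → subst (+ q ∣ℤ_) (sym (ᵛ*-cong (lift x) M≡N j)) (h j)))
    (inKernel? M x) (inKernel? N x)))

  kernelSize-*ʳ : ∀ {k p} (M : Mat k p) (V V′ : Mat p p) → (∀ i j → (V ⊛ V′) i j ≡ idMat i j) →
                  kernelSize (M ⊛ V) ≡ kernelSize M
  kernelSize-*ʳ {k} M V V′ VV′≡I = ∑ᴸ-cong (points k) (λ x → cong 𝟙 (does-⇔
    (mk⇔ (undo x) (λ h j → subst (+ q ∣ℤ_) (ᵛ*-assoc (lift x) M V j) (∣-ᵛ* V h j)))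
    (inKernel? (M ⊛ V) x) (inKernel? M x)))
    where
    undo : ∀ x → InKernel (M ⊛ V) x → InKernel M x
    undo x h j = subst (+ q ∣ℤ_) (ᵛ*-inverse (lift x ᵛ* M) V V′ VV′≡I j)
                   (∣-ᵛ* V′ (λ l → subst (+ q ∣ℤ_) (sym (ᵛ*-assoc (lift x) M V l)) (h l)) j)

  -- x ↦ x U (mod q) permutes (ℤ/q)^k since U is invertible over ℤ.
  kernelSize-*ˡ : ∀ {k p} (U U′ : Mat k k) (M : Mat k p) →
                  (∀ i j → (U ⊛ U′) i j ≡ idMat i j) → (∀ i j → (U′ ⊛ U) i j ≡ idMat i j) →
                  kernelSize (U ⊛ M) ≡ kernelSize M
  kernelSize-*ˡ {k} U U′ M UU′≡I U′U≡I = begin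
    ∑[ x ∈ points k ] 𝟙 (does (inKernel? (U ⊛ M) x))
      ≡⟨ ∑ᴸ-cong (points k) (λ x → cong 𝟙 (does-⇔ (moved x) (inKernel? (U ⊛ M) x)
                                                               (inKernel? M (act U x)))) ⟩
    ∑[ x ∈ points k ] 𝟙 (does (inKernel? M (act U x)))
      ≡⟨ ∑ᴸ-bijection (act U) (act U′) (act-inverse U U′ UU′≡I) (act-inverse U′ U U′U≡I)
                      (λ y → 𝟙 (does (inKernel? M y))) ⟩
    kernelSize M
      ∎
    where
    open ≡-Reasoning
    open Enumeration (VecP.≡-dec Fin._≟_) (points k) (vectors-each-once (allFin-each-once q) k)
    act : Mat k k → Vec (Fin q) k → Vec (Fin q) k
    act A x = reduce (lift x ᵛ* A)
    act-inverse : ∀ A A′ → (∀ i j → (A ⊛ A′) i j ≡ idMat i j) → ∀ x → act A′ (act A x) ≡ x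
    act-inverse A A′ AA′≡I x = reduce-unique _ x (λ i → ≡ₘ-sym
      (≡ₘ-trans (ᵛ*-resp-≡ₘ A′ (lift-reduce (lift x ᵛ* A)) i)
                (≡⇒≡ₘ (ᵛ*-inverse (lift x) A A′ AA′≡I i))))
    shifted : ∀ x j → (lift x ᵛ* (U ⊛ M)) j ≡ₘ (lift (act U x) ᵛ* M) j
    shifted x j = ≡ₘ-trans (≡⇒≡ₘ (sym (ᵛ*-assoc (lift x) U M j)))
                           (ᵛ*-resp-≡ₘ M (λ i → ≡ₘ-sym (lift-reduce (lift x ᵛ* U) i)) j)
    moved : ∀ x → InKernel (U ⊛ M) x ⇔ InKernel M (act U x)
    moved x = mk⇔ (λ h j → ≡ₘ-∣ (≡ₘ-sym (shifted x j)) (h j)) (λ h j → ≡ₘ-∣ (shifted x j) (h j))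

  count-residues : ∀ e → ∑[ a ∈ List.allFin q ] 𝟙 (does (+ q ∣ℤ? + toℕ a * + e)) ≡ + gcd q e
  count-residues e = begin
    ∑[ a ∈ List.allFin q ] 𝟙 (does (+ q ∣ℤ? + toℕ a * + e))
      ≡⟨ ∑ᴸ-tabulate {n = q} (λ a → a) (λ a → 𝟙 (does (+ q ∣ℤ? + toℕ a * + e))) ⟩
    ∑[ a < q ] 𝟙 (does (+ q ∣ℤ? + toℕ a * + e))
      ≡⟨ sum-cong-≗ {q} (λ a → cong 𝟙 (trans (cong (λ z → does (+ q ∣ℤ? z)) (sym (ℤP.pos-* (toℕ a) e)))
                                              (does-∣ℤ? q (toℕ a ℕ.* e)))) ⟩
    ∑[ a < q ] 𝟙 (does (q ∣? toℕ a ℕ.* e))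
      ≡⟨ count-gcd q e ⟩
    + gcd q e
      ∎
    where open ≡-Reasoning

  count-diagonal : ∀ k (ε : Fin k → ℕ) →
    ∑[ y ∈ points k ] 𝟙 (does (FinP.all? (λ i → + q ∣ℤ? lift y i * + ε i)))
      ≡ + product (List.tabulate (λ i → gcd q (ε i)))
  count-diagonal zero    ε = refl
  count-diagonal (suc k) ε = begin
    ∑[ y ∈ points (suc k) ] 𝟙 (does (FinP.all? (condition ε y)))
      ≡⟨ ∑ᴸ-cong (points (suc k)) split ⟩
    ∑[ y ∈ points (suc k) ] (first (Vec.head y) * rest (Vec.tail y))
      ≡⟨ ∑ᴸ-vectors-suc (List.allFin q) k first rest ⟩
    ∑ᴸ (List.allFin q) first * ∑ᴸ (points k) rest
      ≡⟨ cong₂ _*_ (count-residues (ε zero)) (count-diagonal k (ε ∘ suc)) ⟩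
    + gcd q (ε zero) * + product (List.tabulate (λ i → gcd q (ε (suc i))))
      ≡⟨ ℤP.pos-* (gcd q (ε zero)) _ ⟨
    + product (List.tabulate (λ i → gcd q (ε i)))
      ∎
    where
    open ≡-Reasoning
    condition : ∀ {k} (ε : Fin k → ℕ) (y : Vec (Fin q) k) i → Dec (+ q ∣ℤ lift y i * + ε i)
    condition ε y i = + q ∣ℤ? lift y i * + ε i
    first : Fin q → ℤ
    first a = 𝟙 (does (+ q ∣ℤ? + toℕ a * + ε zero))
    rest : Vec (Fin q) k → ℤ
    rest y = 𝟙 (does (FinP.all? (condition (ε ∘ suc) y)))
    split : ∀ y → 𝟙 (does (FinP.all? (condition ε y))) ≡ first (Vec.head y) * rest (Vec.tail y)
    split (x ∷ y) = trans (cong 𝟙 (does-all? (condition ε (x ∷ y))))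
                          (𝟙-∧ (does (+ q ∣ℤ? + toℕ x * + ε zero)) (does (FinP.all? (condition (ε ∘ suc) y))))

  inKernel-diagMat : ∀ {k p} (es : List ℕ) → List.length es ℕ.≤ p → ∀ y →
    InKernel (diagMat {k} {p} es) y ⇔ (∀ i → + q ∣ℤ lift y i * + nth0 es (toℕ i))
  inKernel-diagMat {k} {p} es len≤p y = mk⇔ to from
    where
    from : (∀ i → + q ∣ℤ lift y i * + nth0 es (toℕ i)) → InKernel (diagMat es) y
    from h c = ∣-sum _ term
      where
      term : ∀ i → + q ∣ℤ lift y i * diagMat es i c
      term i with does (toℕ i ℕ.≟ toℕ c)
      ... | true  = h i
      ... | false = subst (+ q ∣ℤ_) (sym (ℤP.*-zeroʳ (lift y i))) (ℤ∣.divides 0ℤ refl)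
    to : InKernel (diagMat es) y → ∀ i → + q ∣ℤ lift y i * + nth0 es (toℕ i)
    to h i with toℕ i ℕ.<? p
    ... | yes i<p = subst (+ q ∣ℤ_) column (h c)
      where
      c = Fin.fromℕ< i<p
      c≡i : toℕ c ≡ toℕ i
      c≡i = FinP.toℕ-fromℕ< i<p
      column : (lift y ᵛ* diagMat es) c ≡ lift y i * + nth0 es (toℕ i)
      column = trans (sum-single _ i off-diagonal)
                     (cong (λ b → lift y i * (if b then + nth0 es (toℕ i) else + 0))
                           (dec-true (toℕ i ℕ.≟ toℕ c) (sym c≡i)))
        where
        off-diagonal : ∀ i′ → i′ ≢ i → lift y i′ * diagMat es i′ c ≡ 0ℤ
        off-diagonal i′ i′≢i = trans
          (cong (λ b → lift y i′ * (if b then + nth0 es (toℕ i′) else + 0))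
                (dec-false (toℕ i′ ℕ.≟ toℕ c) (λ i′≡c → i′≢i (FinP.toℕ-injective (trans i′≡c c≡i)))))
          (ℤP.*-zeroʳ (lift y i′))
    -- A row i ≥ p meets no column; its entry nth0 es i is 0 because length es ≤ p.
    ... | no i≮p = subst (λ e → + q ∣ℤ lift y i * + e)
                         (sym (nth0-≥ es (toℕ i) (ℕP.≤-trans len≤p (ℕP.≮⇒≥ i≮p))))
                         (subst (+ q ∣ℤ_) (sym (ℤP.*-zeroʳ (lift y i))) (ℤ∣.divides 0ℤ refl))

  kernelSize-SNF : ∀ {k p} (M : Mat k p) (snf : SNF M) →
    kernelSize M ≡ + (q ℕ.^ (k ∸ SNF.rank snf) ℕ.* product (List.map (gcd q) (SNF.divs snf)))
  kernelSize-SNF {k} {p} M snf = begin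
    kernelSize M
      ≡⟨ kernelSize-*ˡ U U' M UU' U'U ⟨
    kernelSize (U ⊛ M)
      ≡⟨ kernelSize-*ʳ (U ⊛ M) V V' VV' ⟨
    kernelSize ((U ⊛ M) ⊛ V)
      ≡⟨ kernelSize-cong smith ⟩
    kernelSize (diagMat {k} {p} divs)
      ≡⟨ ∑ᴸ-cong (points k) (λ y → cong 𝟙 (does-⇔ (inKernel-diagMat divs len≤cols y)
                                                   (inKernel? (diagMat divs) y) (diagonal? y))) ⟩
    ∑[ y ∈ points k ] 𝟙 (does (FinP.all? (λ i → + q ∣ℤ? lift y i * + nth0 divs (toℕ i))))
      ≡⟨ count-diagonal k (λ i → nth0 divs (toℕ i)) ⟩
    + product (List.tabulate (λ (i : Fin k) → gcd q (nth0 divs (toℕ i))))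
      ≡⟨ cong +_ (product-gcd-nth0 q k divs len≤rows) ⟩
    + (q ℕ.^ (k ∸ rank) ℕ.* product (List.map (gcd q) divs))
      ∎
    where
    open ≡-Reasoning
    open SNF snf
    diagonal? : ∀ y → Dec (∀ i → + q ∣ℤ lift y i * + nth0 divs (toℕ i))
    diagonal? y = FinP.all? (λ i → + q ∣ℤ? lift y i * + nth0 divs (toℕ i))

PolyZ : Set
PolyZ = List (ℤ × ℕ)

coeffZ : PolyZ → ℕ → ℤ
coeffZ P d = ∑[ m ∈ P ] (if does (proj₂ m ℕ.≟ d) then proj₁ m else 0ℤ)

evalZ : PolyZ → ℕ → ℤ
evalZ P t = ∑[ m ∈ P ] (proj₁ m * + (t ℕ.^ proj₂ m))

degBound : PolyZ → ℕ
degBound = List.foldr (λ m B → suc (proj₂ m) ℕ.⊔ B) 0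

coeffZ-≥degBound : ∀ P d → degBound P ℕ.≤ d → coeffZ P d ≡ 0ℤ
coeffZ-≥degBound []            d _   = refl
coeffZ-≥degBound ((c , e) ∷ P) d deg≤d = begin
  (if does (e ℕ.≟ d) then c else 0ℤ) + coeffZ P d
    ≡⟨ cong₂ (λ b x → (if b then c else 0ℤ) + x) (dec-false (e ℕ.≟ d) e≢d)
             (coeffZ-≥degBound P d (ℕP.m⊔n≤o⇒n≤o (suc e) (degBound P) deg≤d)) ⟩
  0ℤ + 0ℤ
    ≡⟨⟩
  0ℤ
    ∎
  where
  open ≡-Reasoning
  e≢d : e ≢ d
  e≢d e≡d = ℕP.<-irrefl e≡d (ℕP.m⊔n≤o⇒m≤o (suc e) (degBound P) deg≤d)

evalZ-dense : ∀ P B t → degBound P ℕ.≤ B → evalZ P t ≡ ∑[ e < B ] (coeffZ P (toℕ e) * + (t ℕ.^ toℕ e))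
evalZ-dense []            B t _      = sym (sum-replicate-zero B)
evalZ-dense ((c , e) ∷ P) B t deg≤B = begin
  c * + (t ℕ.^ e) + evalZ P t
    ≡⟨ cong₂ _+_ (sym monomial) (evalZ-dense P B t (ℕP.m⊔n≤o⇒n≤o (suc e) (degBound P) deg≤B)) ⟩
  ∑[ e′ < B ] (δ e′ * + (t ℕ.^ toℕ e′)) + ∑[ e′ < B ] (coeffZ P (toℕ e′) * + (t ℕ.^ toℕ e′))
    ≡⟨ ∑-distrib-+ (λ e′ → δ e′ * + (t ℕ.^ toℕ e′)) (λ e′ → coeffZ P (toℕ e′) * + (t ℕ.^ toℕ e′))
     ⟨
  ∑[ e′ < B ] (δ e′ * + (t ℕ.^ toℕ e′) + coeffZ P (toℕ e′) * + (t ℕ.^ toℕ e′))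
    ≡⟨ sum-cong-≗ {B} (λ e′ → sym (ℤP.*-distribʳ-+ (+ (t ℕ.^ toℕ e′)) (δ e′) (coeffZ P (toℕ e′)))) ⟩
  ∑[ e′ < B ] (coeffZ ((c , e) ∷ P) (toℕ e′) * + (t ℕ.^ toℕ e′))
    ∎
  where
  open ≡-Reasoning
  δ : Fin B → ℤ
  δ e′ = if does (e ℕ.≟ toℕ e′) then c else 0ℤ
  e<B : e ℕ.< B
  e<B = ℕP.m⊔n≤o⇒m≤o (suc e) (degBound P) deg≤B
  e′ = Fin.fromℕ< e<B
  monomial : ∑[ e′ < B ] (δ e′ * + (t ℕ.^ toℕ e′)) ≡ c * + (t ℕ.^ e)
  monomial = trans (sum-single (λ e′ → δ e′ * + (t ℕ.^ toℕ e′)) e′ elsewhere)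
                   (cong₂ (λ b x → (if b then c else 0ℤ) * + (t ℕ.^ x))
                          (dec-true (e ℕ.≟ toℕ e′) (sym (FinP.toℕ-fromℕ< e<B))) (FinP.toℕ-fromℕ< e<B))
    where
    elsewhere : ∀ e″ → e″ ≢ e′ → δ e″ * + (t ℕ.^ toℕ e″) ≡ 0ℤ
    elsewhere e″ e″≢e′ = cong (λ b → (if b then c else 0ℤ) * + (t ℕ.^ toℕ e″))
      (dec-false (e ℕ.≟ toℕ e″) (λ e≡e″ → e″≢e′ (FinP.toℕ-injective (trans (sym e≡e″) (sym (FinP.toℕ-fromℕ< e<B))))))

evalZ-zero : ∀ P t → (∀ d → coeffZ P d ≡ 0ℤ) → evalZ P t ≡ 0ℤ
evalZ-zero P t coeff≡0 = trans (evalZ-dense P (degBound P) t ℕP.≤-refl)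
  (trans (sum-cong-≗ {degBound P} (λ e → cong (_* + (t ℕ.^ toℕ e)) (coeff≡0 (toℕ e))))
         (sum-replicate-zero (degBound P)))

evalZ-if : ∀ b X t → evalZ (if b then X else []) t ≡ 𝟙 b * evalZ X t
evalZ-if true  X t = sym (ℤP.*-identityˡ (evalZ X t))
evalZ-if false X t = refl

*-evalZ-concatMap-if : ∀ c (xs : List X) (b : X → Bool) (P : X → PolyZ) t →
  c * evalZ (concatMap (λ x → if b x then P x else []) xs) t ≡ ∑[ x ∈ xs ] (𝟙 (b x) * (c * evalZ (P x) t))
*-evalZ-concatMap-if c xs b P t = begin
  c * evalZ (concatMap (λ x → if b x then P x else []) xs) t
    ≡⟨ cong (c *_) (∑ᴸ-concatMap (λ x → if b x then P x else []) xs _) ⟩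
  c * ∑[ x ∈ xs ] evalZ (if b x then P x else []) t
    ≡⟨ *-distribˡ-∑ᴸ c xs (λ x → evalZ (if b x then P x else []) t) ⟩
  ∑[ x ∈ xs ] (c * evalZ (if b x then P x else []) t)
    ≡⟨ ∑ᴸ-cong xs (λ x → trans (cong (c *_) (evalZ-if (b x) (P x) t))
                               (x∙yz≈y∙xz c (𝟙 (b x)) (evalZ (P x) t))) ⟩
  ∑[ x ∈ xs ] (𝟙 (b x) * (c * evalZ (P x) t))
    ∎
  where open ≡-Reasoning

divisible-by-unbounded⇒0 : ∀ (qs : ℕ → ℕ) → (∀ N → N ℕ.< qs N) →
                           ∀ z → (∀ N → + qs N ∣ℤ z) → z ≡ 0ℤ
divisible-by-unbounded⇒0 qs N<qs z qs∣z with ℤ.∣ z ∣ in ∣z∣≡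
... | zero  = ℤP.∣i∣≡0⇒i≡0 ∣z∣≡
... | suc a = contradiction (N<qs (suc a))
                (ℕP.≤⇒≯ (ℕ∣.∣⇒≤ (subst (qs (suc a) ∣_) ∣z∣≡ (ℤ∣.∣⇒∣ᵤ (qs∣z (suc a))))))

horner : ∀ B (c : ℕ → ℤ) t →
         ∑[ e < suc B ] (c (toℕ e) * + (t ℕ.^ toℕ e))
           ≡ c 0 + + t * ∑[ e < B ] (c (suc (toℕ e)) * + (t ℕ.^ toℕ e))
horner B c t = cong₂ _+_ (ℤP.*-identityʳ (c 0))
  (trans (sum-cong-≗ {B} (λ e → trans (cong (c (suc (toℕ e)) *_) (ℤP.pos-* t (t ℕ.^ toℕ e)))
                                      (x∙yz≈y∙xz (c (suc (toℕ e))) (+ t) (+ (t ℕ.^ toℕ e)))))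
         (sym (*-distribˡ-sum {B} (+ t) (λ e → c (suc (toℕ e)) * + (t ℕ.^ toℕ e)))))

-- The constant term is divisible by every point of the sequence, hence 0;
-- dividing by t and recursing handles the other coefficients.
dense-vanishing : ∀ B (c : ℕ → ℤ) (qs : ℕ → ℕ) → (∀ N → N ℕ.< qs N) →
                  (∀ N → ∑[ e < B ] (c (toℕ e) * + (qs N ℕ.^ toℕ e)) ≡ 0ℤ) →
                  ∀ e → e ℕ.< B → c e ≡ 0ℤ
dense-vanishing (suc B) c qs N<qs vanish = coefficient
  where
  R : ℕ → ℤ
  R t = ∑[ e < B ] (c (suc (toℕ e)) * + (t ℕ.^ toℕ e))
  c0+tR≡0 : ∀ N → c 0 + + qs N * R (qs N) ≡ 0ℤ
  c0+tR≡0 N = trans (sym (horner B c (qs N))) (vanish N)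
  c0≡0 : c 0 ≡ 0ℤ
  c0≡0 = divisible-by-unbounded⇒0 qs N<qs (c 0) (λ N → ℤ∣.divides (- R (qs N))
           (solve-linear (c 0) (+ qs N) (R (qs N)) (c0+tR≡0 N)))
    where
    solve-linear : ∀ a t r → a + t * r ≡ 0ℤ → a ≡ - r * t
    solve-linear a t r eq = trans (isolate a t r) (trans (cong (_- t * r) eq) (commute t r))
      where
      isolate : ∀ a t r → a ≡ (a + t * r) - t * r
      isolate = solve-∀
      commute : ∀ t r → 0ℤ - t * r ≡ - r * t
      commute = solve-∀
  R≡0 : ∀ N → R (qs N) ≡ 0ℤ
  R≡0 N = ℤP.*-cancelˡ-≡ (+ qs N) (R (qs N)) 0ℤ {{ℕ.>-nonZero (ℕP.≤-<-trans ℕ.z≤n (N<qs N))}}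
            (trans (sym (ℤP.+-identityˡ _)) (trans (cong (_+ + qs N * R (qs N)) (sym c0≡0))
                                                   (trans (c0+tR≡0 N) (sym (ℤP.*-zeroʳ (+ qs N))))))
  coefficient : ∀ e → e ℕ.< suc B → c e ≡ 0ℤ
  coefficient zero    _            = c0≡0
  coefficient (suc e) (ℕ.s≤s e<B) = dense-vanishing B (c ∘ suc) qs N<qs R≡0 e e<B

coeffZ-unique : ∀ A C (qs : ℕ → ℕ) → (∀ N → N ℕ.< qs N) →
                (∀ N → evalZ A (qs N) ≡ evalZ C (qs N)) → ∀ d → coeffZ A d ≡ coeffZ C d
coeffZ-unique A C qs N<qs A≡C d with d ℕ.<? degBound A ℕ.⊔ degBound C
... | no d≮B = trans (coeffZ-≥degBound A d (ℕP.≤-trans (ℕP.m≤m⊔n _ _) (ℕP.≮⇒≥ d≮B)))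
                     (sym (coeffZ-≥degBound C d (ℕP.≤-trans (ℕP.m≤n⊔m _ _) (ℕP.≮⇒≥ d≮B))))
... | yes d<B = ℤP.i-j≡0⇒i≡j _ _ (dense-vanishing bound (λ e → coeffZ A e - coeffZ C e) qs N<qs difference d d<B)
  where
  bound = degBound A ℕ.⊔ degBound C
  difference : ∀ N → ∑[ e < bound ] ((coeffZ A (toℕ e) - coeffZ C (toℕ e)) * + (qs N ℕ.^ toℕ e)) ≡ 0ℤ
  difference N = begin
    ∑[ e < bound ] ((coeffZ A (toℕ e) - coeffZ C (toℕ e)) * + (t ℕ.^ toℕ e))
      ≡⟨ sum-cong-≗ {bound} (λ e → distrib (coeffZ A (toℕ e)) (coeffZ C (toℕ e)) (+ (t ℕ.^ toℕ e))) ⟩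
    ∑[ e < bound ] (coeffZ A (toℕ e) * + (t ℕ.^ toℕ e) - coeffZ C (toℕ e) * + (t ℕ.^ toℕ e))
      ≡⟨ sum-distrib-- {bound} (λ e → coeffZ A (toℕ e) * + (t ℕ.^ toℕ e))
                               (λ e → coeffZ C (toℕ e) * + (t ℕ.^ toℕ e)) ⟩
    ∑[ e < bound ] (coeffZ A (toℕ e) * + (t ℕ.^ toℕ e)) - ∑[ e < bound ] (coeffZ C (toℕ e) * + (t ℕ.^ toℕ e))
      ≡⟨ cong₂ _-_ (evalZ-dense A bound t (ℕP.m≤m⊔n _ _)) (evalZ-dense C bound t (ℕP.m≤n⊔m _ _)) ⟨
    evalZ A t - evalZ C t
      ≡⟨ cong (_- evalZ C t) (A≡C N) ⟩
    evalZ C t - evalZ C t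
      ≡⟨ ℤP.+-inverseʳ (evalZ C t) ⟩
    0ℤ
      ∎
    where
    open ≡-Reasoning
    t = qs N
    distrib : ∀ a b c → (a - b) * c ≡ a * c - b * c
    distrib = solve-∀

module DivideBy (b : ℕ) where

  φ : ℤ → ℚ
  φ z = z ℚ./ suc b

  φ-+ : ∀ x y → φ (x + y) ≡ φ x ℚ.+ φ y
  φ-+ x y = ℚP.toℚᵘ-injective (ℚᵘP.≃-sym (begin
    ℚ.toℚᵘ (φ x ℚ.+ φ y)             ≈⟨ ℚP.toℚᵘ-homo-+ (φ x) (φ y) ⟩
    ℚ.toℚᵘ (φ x) ℚᵘ.+ ℚ.toℚᵘ (φ y)   ≈⟨ ℚᵘP.+-cong (ℚP.toℚᵘ-fromℚᵘ (ℚᵘ.mkℚᵘ x b))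
                                                    (ℚP.toℚᵘ-fromℚᵘ (ℚᵘ.mkℚᵘ y b)) ⟩
    ℚᵘ.mkℚᵘ x b ℚᵘ.+ ℚᵘ.mkℚᵘ y b     ≈⟨ same-denominator ⟩
    ℚᵘ.mkℚᵘ (x + y) b                 ≈⟨ ℚP.toℚᵘ-fromℚᵘ (ℚᵘ.mkℚᵘ (x + y) b) ⟨
    ℚ.toℚᵘ (φ (x + y))               ∎))
    where
    open ℚᵘP.≃-Reasoning
    same-denominator : ℚᵘ.mkℚᵘ x b ℚᵘ.+ ℚᵘ.mkℚᵘ y b ℚᵘ.≃ ℚᵘ.mkℚᵘ (x + y) b
    same-denominator = ℚᵘ.*≡* (trans (rearrange x y (+ suc b)) (cong ((x + y) *_) (ℤP.pos-* (suc b) (suc b))))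
      where
      rearrange : ∀ x y g → (x * g + y * g) * g ≡ (x + y) * (g * g)
      rearrange = solve-∀

  φ-0 : φ 0ℤ ≡ 0ℚ
  φ-0 = ℚP.0/n≡0 (suc b)

  φ-neg : ∀ z → φ (- z) ≡ ℚ.- φ z
  φ-neg z = inverseˡ-unique (φ (- z)) (φ z)
    (trans (sym (φ-+ (- z) z)) (trans (cong φ (ℤP.+-inverseˡ z)) φ-0))

  φ-sgn : ∀ j z → sgn j ℚ.* φ z ≡ φ (-1ℤ ^ j * z)
  φ-sgn zero    z = trans (ℚP.*-identityˡ (φ z)) (cong φ (sym (ℤP.*-identityˡ z)))
  φ-sgn (suc j) z = begin
    ℚ.- sgn j ℚ.* φ z        ≡⟨ ℚP.neg-distribˡ-* (sgn j) (φ z) ⟨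
    ℚ.- (sgn j ℚ.* φ z)      ≡⟨ cong ℚ.-_ (φ-sgn j z) ⟩
    ℚ.- φ (-1ℤ ^ j * z)      ≡⟨ φ-neg (-1ℤ ^ j * z) ⟨
    φ (- (-1ℤ ^ j * z))      ≡⟨ cong φ (negate (-1ℤ ^ j) z) ⟩
    φ (-1ℤ ^ suc j * z)      ∎
    where
    open ≡-Reasoning
    negate : ∀ s z → - (s * z) ≡ -1ℤ * s * z
    negate = solve-∀

  φ-denominator : φ (+ suc b) ≡ 1ℚ
  φ-denominator =
    ℚP.fromℚᵘ-cong {ℚᵘ.mkℚᵘ (+ suc b) b} {ℚᵘ.mkℚᵘ 1ℤ 0} (ℚᵘ.*≡* (ℤP.*-comm (+ suc b) 1ℤ))

  φ≡0⇒≡0 : ∀ z → φ z ≡ 0ℚ → z ≡ 0ℤ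
  φ≡0⇒≡0 z φz≡0 with ℚP.fromℚᵘ-injective {ℚᵘ.mkℚᵘ z b} {ℚᵘ.mkℚᵘ 0ℤ b} (trans φz≡0 (sym φ-0))
  ... | ℚᵘ.*≡* z*g≡0*g = ℤP.*-cancelʳ-≡ z 0ℤ (+ suc b) z*g≡0*g

  scale : PolyZ → Poly
  scale = List.map (λ m → φ (proj₁ m) , proj₂ m)

  coeff-scale : ∀ P d → coeff (scale P) d ≡ φ (coeffZ P d)
  coeff-scale []            d = sym φ-0
  coeff-scale ((z , e) ∷ P) d with does (e ℕ.≟ d)
  ... | true  = trans (cong (φ z ℚ.+_) (coeff-scale P d)) (sym (φ-+ z (coeffZ P d)))
  ... | false = trans (coeff-scale P d) (cong φ (sym (ℤP.+-identityˡ (coeffZ P d))))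

∈⇒∣last : ∀ {k n} (G : Mat k n) (s : SNFs G) {e} xs → Linked _∣_ xs → e ∈ᴸ xs → e ∣ lastDiv G s xs
∈⇒∣last G s (x ∷ [])     _           (here refl) = ℕ∣.∣-refl
∈⇒∣last G s (x ∷ y ∷ xs) (x∣y ∷ y∣…) (here refl) =
  ℕ∣.∣-trans x∣y (∈⇒∣last G s (y ∷ xs) y∣… (here refl))
∈⇒∣last G s (x ∷ y ∷ xs) (_ ∷ y∣…)   (there e∈)  = ∈⇒∣last G s (y ∷ xs) y∣… e∈

module _ {k n : ℕ} (G : Mat k n) (s : SNFs G) where

  lastDiv∣ρ₀ : ∀ K → ∣ K ∣ ≢ 0 → lastDiv G s (eds G s K) ∣ ρ₀ G s
  lastDiv∣ρ₀ K ∣K∣≢0 = go (subsets n) (∈-subsets n K)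
    where
    go : ∀ Ls → K ∈ᴸ Ls → lastDiv G s (eds G s K) ∣ List.foldr (λ J acc → if does (∣ J ∣ ℕ.≟ 0) then acc
                                                         else lcm (lastDiv G s (eds G s J)) acc) 1 Ls
    go (K ∷ Ls) (here refl) rewrite dec-false (∣ K ∣ ℕ.≟ 0) ∣K∣≢0 = m∣lcm[m,n] _ _
    go (J ∷ Ls) (there K∈Ls) with does (∣ J ∣ ℕ.≟ 0)
    ... | true  = go Ls K∈Ls
    ... | false = ℕ∣.∣-trans (go Ls K∈Ls) (n∣lcm[m,n] (lastDiv G s (eds G s J)) _)

  eds∣ρ₀ : ∀ K → All (_∣ ρ₀ G s) (eds G s K)
  eds∣ρ₀ K with ∣ K ∣ ℕ.≟ 0
  ... | no ∣K∣≢0 = All.tabulate (λ e∈ → ℕ∣.∣-trans (∈⇒∣last G s (eds G s K) (SNF.divs-chain (s K)) e∈)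
                                                   (lastDiv∣ρ₀ K ∣K∣≢0))
  ... | yes ∣K∣≡0 = no-divisors (eds G s K)
                      (subst (List.length (eds G s K) ℕ.≤_) (trans (length-elems K) ∣K∣≡0) (SNF.len≤cols (s K)))
    where
    no-divisors : ∀ es → List.length es ℕ.≤ 0 → All (_∣ ρ₀ G s) es
    no-divisors [] _ = []

  gprod-periodic : ∀ m N K → gprod G s (m ℕ.+ ρ₀ G s ℕ.* N) K ≡ gprod G s m K
  gprod-periodic m N K =
    cong product (ListP.map-cong-local (All.map (gcd-periodic m (ρ₀ G s) N _) (eds∣ρ₀ K)))

  module AtModulus (q : ℕ) .{{_ : NonZero q}} where
    open Modular q

    zeroColumns : Vec (Fin q) k → Subset n
    zeroColumns x = Vec.tabulate (λ j → does (+ q ∣ℤ? (lift x ᵛ* G) j))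

    open SubsetCounts (points k) zeroColumns public

    atLeast≡ : ∀ K → atLeast K ≡ + (q ℕ.^ (k ∸ r G s K) ℕ.* gprod G s q K)
    atLeast≡ K = trans (∑ᴸ-cong (points k) (λ x → cong 𝟙 (columns x))) (kernelSize-SNF (cols G K) (s K))
      where
      columns : ∀ x → does (K ⊆? zeroColumns x) ≡ does (inKernel? (cols G K) x)
      columns x = begin
        does (K ⊆? zeroColumns x)
          ≡⟨ does-⊆? K (zeroColumns x) ⟩
        all (Vec.lookup (zeroColumns x)) (elems K)
          ≡⟨ cong and (ListP.map-cong (VecP.lookup∘tabulate _) (elems K)) ⟩
        all (λ j → does (+ q ∣ℤ? (lift x ᵛ* G) j)) (elems K)
          ≡⟨ does-all?-lookup (elems K) (λ j → + q ∣ℤ? (lift x ᵛ* G) j) ⟨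
        does (inKernel? (cols G K) x)
          ∎
        where open ≡-Reasoning

  -- r is only known through the chosen Smith forms.  Counting modulo q = 1 + ρ₀,
  -- where all the gcds are 1, gives q ^ (k ∸ r E) ≤ q ^ (k ∸ r K).
  r≤r-full : 1 ℕ.≤ ρ₀ G s → ∀ K → r G s K ℕ.≤ r G s full
  r≤r-full 1≤ρ₀ K = ℕP.∸-cancelʳ-≤ (SNF.len≤rows (s K)) exponents
    where
    q = 1 ℕ.+ ρ₀ G s ℕ.* 1
    1<q : 1 ℕ.< q
    1<q = ℕ.s≤s (subst (1 ℕ.≤_) (sym (ℕP.*-identityʳ (ρ₀ G s))) 1≤ρ₀)
    instance
      q≢0 : NonZero q
      q≢0 = _
    open AtModulus q
    coprime : ∀ L → gprod G s q L ≡ 1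
    coprime L = trans (gprod-periodic 1 1 L) (product-gcd-1 (eds G s L))
    count : ∀ L → atLeast L ≡ + (q ℕ.^ (k ∸ r G s L))
    count L = trans (atLeast≡ L) (cong +_ (trans (cong (q ℕ.^ (k ∸ r G s L) ℕ.*_) (coprime L))
                                                 (ℕP.*-identityʳ _)))
    powers : q ℕ.^ (k ∸ r G s full) ℕ.≤ q ℕ.^ (k ∸ r G s K)
    powers = ℤP.drop‿+≤+ (subst₂ ℤ._≤_ (count full) (count K) (atLeast-full-≤ K))
    exponents : k ∸ r G s full ℕ.≤ k ∸ r G s K
    exponents = ℕP.≮⇒≥ (λ lt → ℕP.<⇒≱ (ℕP.^-monoʳ-< q 1<q lt) powers)

module Proof {k n : ℕ} (G : Mat k n) (s : SNFs G) (m : ℕ) (1≤m : 1 ℕ.≤ m) (m≤ρ₀ : m ℕ.≤ ρ₀ G s) where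

  ρ rE : ℕ
  ρ  = ρ₀ G s
  rE = r G s full

  g : Subset n → ℕ
  g = gprod G s m

  layer? : ∀ i (J : Subset n) → Dec (∣ J ∣ ℕ.+ i ≡ n)
  layer? i J = (∣ J ∣ ℕ.+ i) ℕ.≟ n

  exactPoly : Subset n → PolyZ
  exactPoly J = concatMap (λ K → if does (J ⊆? K)
                                   then [ (-1ℤ ^ (∣ K ∣ ∸ ∣ J ∣) * + g K , rE ∸ r G s K) ]
                                   else [])
                          (subsets n)

  fPoly : ℕ → PolyZ
  fPoly i = concatMap (λ J → if does (layer? i J) then exactPoly J else []) (subsets n)

  rhsPoly : ℕ → PolyZ
  rhsPoly i = concatMap (λ J → if does (layer? i J) then (+ g J , rE ∸ r G s J) ∷ (- + g full , 0) ∷ [] else [])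
                        (subsets n)

  g≢0 : ∀ K → NonZero (g K)
  g≢0 K = product≢0 (AllP.map⁺ (All.universal gcd≢0 (eds G s K)))
    where
    gcd≢0 : ∀ e → NonZero (gcd m e)
    gcd≢0 e = ℕ.≢-nonZero (gcd[m,n]≢0 m e (inj₁ (λ m≡0 → ℕP.<⇒≢ 1≤m (sym m≡0))))

  open DivideBy (ℕ.pred (g full)) public

  g-full≡ : g full ≡ suc (ℕ.pred (g full))
  g-full≡ = sym (ℕP.suc-pred (g full) {{g≢0 full}})

  frac≡φ : ∀ a → frac a (g full) ≡ φ (+ a)
  frac≡φ a = by-denominator (g full) g-full≡
    where
    by-denominator : ∀ c → c ≡ suc (ℕ.pred (g full)) → frac a c ≡ φ (+ a)
    by-denominator _ refl = refl

  scale-concatMap : ∀ {X : Set} (hℚ : X → Poly) (hℤ : X → PolyZ) → (∀ x → hℚ x ≡ scale (hℤ x)) →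
                    ∀ xs → concatMap hℚ xs ≡ scale (concatMap hℤ xs)
  scale-concatMap hℚ hℤ hℚ≡ xs = trans (ListP.concatMap-cong hℚ≡ xs) (sym (ListP.map-concatMap _ hℤ xs))

  scale-if : ∀ b {X Y} → X ≡ scale Y → (if b then X else []) ≡ scale (if b then Y else [])
  scale-if true  X≡ = X≡
  scale-if false _  = refl

  f≡scale : ∀ i → f G s i m ≡ scale (fPoly i)
  f≡scale i = scale-concatMap _ _ (λ J → scale-if (does (layer? i J))
                (scale-concatMap _ _ (λ K → scale-if (does (J ⊆? K))
                  (cong (λ c → [ (c , rE ∸ r G s K) ])
                        (trans (cong (sgn (∣ K ∣ ∸ ∣ J ∣) ℚ.*_) (frac≡φ (g K)))
                               (φ-sgn (∣ K ∣ ∸ ∣ J ∣) (+ g K)))))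
                  (subsets n)))
              (subsets n)

  rhs≡scale : ∀ i → rhs G s i m ≡ scale (rhsPoly i)
  rhs≡scale i = scale-concatMap _ _ (λ J → scale-if (does (layer? i J))
                  (cong₂ (λ c c′ → (c , rE ∸ r G s J) ∷ (c′ , 0) ∷ []) (frac≡φ (g J)) minus-one))
                (subsets n)
    where
    minus-one : ℚ.- 1ℚ ≡ φ (- + g full)
    minus-one = sym (trans (φ-neg (+ g full))
                           (cong ℚ.-_ (trans (cong (φ ∘ +_) g-full≡) φ-denominator)))

  modulus : ℕ → ℕ
  modulus N = m ℕ.+ ρ ℕ.* N

  N<modulus : ∀ N → N ℕ.< modulus N
  N<modulus N = ℕP.≤-trans (ℕ.s≤s (ℕP.m≤n*m N ρ {{ℕ.>-nonZero (ℕP.≤-trans 1≤m m≤ρ₀)}}))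
                           (ℕP.+-monoˡ-≤ (ρ ℕ.* N) 1≤m)

  rK≤rE : ∀ K → r G s K ℕ.≤ rE
  rK≤rE = r≤r-full G s (ℕP.≤-trans 1≤m m≤ρ₀)

  module Counting (N : ℕ) where
    q : ℕ
    q = modulus N

    instance
      q≢0 : NonZero q
      q≢0 = ℕ.>-nonZero (ℕP.≤-trans 1≤m (ℕP.m≤m+n m (ρ ℕ.* N)))

    open AtModulus G s q public

    Q₀ : ℕ
    Q₀ = q ℕ.^ (k ∸ rE)

    atLeast-split : ∀ K → atLeast K ≡ + Q₀ * (+ g K * + (q ℕ.^ (rE ∸ r G s K)))
    atLeast-split K = begin
      atLeast K
        ≡⟨ atLeast≡ K ⟩
      + (q ℕ.^ (k ∸ r G s K) ℕ.* gprod G s q K)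
        ≡⟨ cong₂ (λ e x → + (q ℕ.^ e ℕ.* x)) exponent (gprod-periodic G s m N K) ⟩
      + (q ℕ.^ ((k ∸ rE) ℕ.+ (rE ∸ r G s K)) ℕ.* g K)
        ≡⟨ cong (λ x → + (x ℕ.* g K)) (ℕP.^-distribˡ-+-* q (k ∸ rE) (rE ∸ r G s K)) ⟩
      + (Q₀ ℕ.* q ℕ.^ (rE ∸ r G s K) ℕ.* g K)
        ≡⟨ cong +_ (trans (ℕP.*-assoc Q₀ _ (g K)) (cong (Q₀ ℕ.*_) (ℕP.*-comm _ (g K)))) ⟩
      + (Q₀ ℕ.* (g K ℕ.* q ℕ.^ (rE ∸ r G s K)))
        ≡⟨ trans (ℤP.pos-* Q₀ _) (cong (+ Q₀ *_) (ℤP.pos-* (g K) _)) ⟩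
      + Q₀ * (+ g K * + (q ℕ.^ (rE ∸ r G s K)))
        ∎
      where
      open ≡-Reasoning
      exponent : k ∸ r G s K ≡ (k ∸ rE) ℕ.+ (rE ∸ r G s K)
      exponent = trans (cong (_∸ r G s K) (sym (ℕP.m∸n+n≡m (SNF.len≤rows (s full)))))
                       (ℕP.+-∸-assoc (k ∸ rE) (rK≤rE K))

    exactly≡evalZ : ∀ J → exactly J ≡ + Q₀ * evalZ (exactPoly J) q
    exactly≡evalZ J = begin
      exactly J
        ≡⟨ exactly≡∑atLeast J ⟩
      ∑[ K ∈ subsets n ] (𝟙 (does (J ⊆? K)) * (-1ℤ ^ (∣ K ∣ ∸ ∣ J ∣) * atLeast K))
        ≡⟨ ∑ᴸ-cong (subsets n) (λ K → cong (𝟙 (does (J ⊆? K)) *_) (monomial K)) ⟩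
      ∑[ K ∈ subsets n ] (𝟙 (does (J ⊆? K)) * (+ Q₀ * evalZ (term K) q))
        ≡⟨ *-evalZ-concatMap-if (+ Q₀) (subsets n) (λ K → does (J ⊆? K)) term q ⟨
      + Q₀ * evalZ (exactPoly J) q
        ∎
      where
      open ≡-Reasoning
      term : Subset n → PolyZ
      term K = [ (-1ℤ ^ (∣ K ∣ ∸ ∣ J ∣) * + g K , rE ∸ r G s K) ]
      rearrange : ∀ σ Q c t → σ * (Q * (c * t)) ≡ Q * ((σ * c) * t + 0ℤ)
      rearrange = solve-∀
      monomial : ∀ K → -1ℤ ^ (∣ K ∣ ∸ ∣ J ∣) * atLeast K ≡ + Q₀ * evalZ (term K) q
      monomial K = trans (cong (-1ℤ ^ (∣ K ∣ ∸ ∣ J ∣) *_) (atLeast-split K))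
                         (rearrange (-1ℤ ^ (∣ K ∣ ∸ ∣ J ∣)) (+ Q₀) (+ g K) (+ (q ℕ.^ (rE ∸ r G s K))))

    fPoly-count : ∀ i → + Q₀ * evalZ (fPoly i) q ≡ ∑[ J ∈ subsets n ] (𝟙 (does (layer? i J)) * exactly J)
    fPoly-count i = trans (*-evalZ-concatMap-if (+ Q₀) (subsets n) (does ∘ layer? i) exactPoly q)
      (∑ᴸ-cong (subsets n) (λ J → cong (𝟙 (does (layer? i J)) *_) (sym (exactly≡evalZ J))))

    rhsPoly-count : ∀ i → + Q₀ * evalZ (rhsPoly i) q
                          ≡ ∑[ J ∈ subsets n ] (𝟙 (does (layer? i J)) * (atLeast J - atLeast full))
    rhsPoly-count i = trans (*-evalZ-concatMap-if (+ Q₀) (subsets n) (does ∘ layer? i) pair q)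
      (∑ᴸ-cong (subsets n) (λ J → cong (𝟙 (does (layer? i J)) *_) (pair-count J)))
      where
      open ≡-Reasoning
      pair : Subset n → PolyZ
      pair J = (+ g J , rE ∸ r G s J) ∷ (- + g full , 0) ∷ []
      expand : ∀ Q a c → Q * (a + (- c * 1ℤ + 0ℤ)) ≡ Q * a - Q * (c * 1ℤ)
      expand = solve-∀
      pair-count : ∀ J → + Q₀ * evalZ (pair J) q ≡ atLeast J - atLeast full
      pair-count J = begin
        + Q₀ * (+ g J * + (q ℕ.^ (rE ∸ r G s J)) + (- + g full * 1ℤ + 0ℤ))
          ≡⟨ expand (+ Q₀) (+ g J * + (q ℕ.^ (rE ∸ r G s J))) (+ g full) ⟩
        + Q₀ * (+ g J * + (q ℕ.^ (rE ∸ r G s J))) - + Q₀ * (+ g full * 1ℤ)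
          ≡⟨ cong₂ _-_ (sym (atLeast-split J)) (sym (trans (atLeast-split full)
                 (cong (λ e → + Q₀ * (+ g full * + (q ℕ.^ e))) (ℕP.n∸n≡0 rE)))) ⟩
        atLeast J - atLeast full
          ∎

  module Minimal (d : ℕ) (d-minimal : IsD' G s m d) where

    fPoly-vanishes : ∀ i → 1 ℕ.≤ i → i ℕ.< d → ∀ e → coeffZ (fPoly i) e ≡ 0ℤ
    fPoly-vanishes i 1≤i i<d e = φ≡0⇒≡0 (coeffZ (fPoly i) e) (begin
      φ (coeffZ (fPoly i) e)    ≡⟨ coeff-scale (fPoly i) e ⟨
      coeff (scale (fPoly i)) e ≡⟨ cong (λ P → coeff P e) (f≡scale i) ⟨
      coeff (f G s i m) e       ≡⟨ proj₂ (proj₂ d-minimal) i 1≤i i<d e ⟩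
      0ℚ                        ∎)
      where open ≡-Reasoning

    module Layers (N : ℕ) where
      open Counting N
      open Enumeration _≟ˢ_ (subsets n) (subsets-each-once n)

      exactly-vanishes : ∀ L → ∣ L ∣ ℕ.< n → n ℕ.< ∣ L ∣ ℕ.+ d → exactly L ≡ 0ℤ
      exactly-vanishes L ∣L∣<n n<∣L∣+d = begin
        exactly L
          ≡⟨ ℤP.*-identityˡ (exactly L) ⟨
        1ℤ * exactly L
          ≡⟨ cong (λ b → 𝟙 b * exactly L) (dec-true (layer? i L) on-layer) ⟨
        𝟙 (does (layer? i L)) * exactly L
          ≡⟨ ∑ᴸ-nonneg-≡0 (λ J → 𝟙*-nonneg (does (layer? i J)) (exactly-nonneg J)) layer-sum L ⟩
        0ℤ
          ∎
        where
        open ≡-Reasoning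
        i = n ∸ ∣ L ∣
        on-layer : ∣ L ∣ ℕ.+ i ≡ n
        on-layer = ℕP.m+[n∸m]≡n (ℕP.<⇒≤ ∣L∣<n)
        i<d : i ℕ.< d
        i<d = subst (i ℕ.<_) (ℕP.m+n∸m≡n ∣ L ∣ d) (ℕP.∸-monoˡ-< n<∣L∣+d (ℕP.<⇒≤ ∣L∣<n))
        layer-sum : ∑[ J ∈ subsets n ] (𝟙 (does (layer? i J)) * exactly J) ≡ 0ℤ
        layer-sum = trans (sym (fPoly-count i))
          (trans (cong (+ Q₀ *_) (evalZ-zero (fPoly i) q (fPoly-vanishes i (ℕP.m<n⇒0<n∸m ∣L∣<n) i<d)))
                 (ℤP.*-zeroʳ (+ Q₀)))

      exactly-on-layer : ∀ J → ∣ J ∣ ℕ.+ d ≡ n → exactly J ≡ atLeast J - atLeast full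
      exactly-on-layer J on-layer = begin
        exactly J                                 ≡⟨ isolate (exactly J) (exactly full) ⟩
        (exactly J + exactly full) - exactly full ≡⟨ cong₂ _-_ (sym two-terms) exactly-full ⟩
        atLeast J - atLeast full                  ∎
        where
        open ≡-Reasoning
        isolate : ∀ a b → a ≡ (a + b) - b
        isolate = solve-∀
        J≢full : J ≢ full
        J≢full J≡full = ℕP.<-irrefl (trans (cong ∣_∣ J≡full) ∣full∣≡n)
          (subst (∣ J ∣ ℕ.<_) on-layer (ℕP.m<m+n ∣ J ∣ (proj₁ d-minimal)))
        split : ∀ L → 𝟙 (does (J ⊆? L)) * exactly L
                      ≡ 𝟙 (does (L ≟ˢ J)) * exactly L + 𝟙 (does (L ≟ˢ full)) * exactly L
        split L with L ≟ˢ J | L ≟ˢ full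
        ... | yes refl | yes L≡full = contradiction L≡full J≢full
        ... | yes refl | no _       = trans (cong (λ b → 𝟙 b * exactly J) (dec-true (J ⊆? J) SubsetP.⊆-refl))
                                            (sym (ℤP.+-identityʳ _))
        ... | no _     | yes refl   = trans (cong (λ b → 𝟙 b * exactly full) (dec-true (J ⊆? full) (⊆-full J)))
                                            (sym (ℤP.+-identityˡ _))
        ... | no L≢J   | no L≢full  with J ⊆? L
        ...   | no _    = refl
        ...   | yes J⊆L = cong (1ℤ *_) (exactly-vanishes L (≢full⇒∣∣< L≢full) n<∣L∣+d)
          where
          n<∣L∣+d : n ℕ.< ∣ L ∣ ℕ.+ d
          n<∣L∣+d = subst (ℕ._< ∣ L ∣ ℕ.+ d) on-layer (ℕP.+-monoˡ-< d (⊆-≢⇒∣∣< J⊆L (L≢J ∘ sym)))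
        two-terms : atLeast J ≡ exactly J + exactly full
        two-terms = trans (atLeast≡∑exactly J) (trans (∑ᴸ-cong (subsets n) split)
          (trans (∑ᴸ-distrib-+ (subsets n) _ _) (cong₂ _+_ (∑ᴸ-δ J exactly) (∑ᴸ-δ full exactly))))

      evalZ-agree : evalZ (fPoly d) q ≡ evalZ (rhsPoly d) q
      evalZ-agree = ℤP.*-cancelˡ-≡ (+ Q₀) _ _ {{ℕP.m^n≢0 q (k ∸ rE)}} (begin
        + Q₀ * evalZ (fPoly d) q
          ≡⟨ fPoly-count d ⟩
        ∑[ J ∈ subsets n ] (𝟙 (does (layer? d J)) * exactly J)
          ≡⟨ ∑ᴸ-cong (subsets n) by-layer ⟩
        ∑[ J ∈ subsets n ] (𝟙 (does (layer? d J)) * (atLeast J - atLeast full))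
          ≡⟨ rhsPoly-count d ⟨
        + Q₀ * evalZ (rhsPoly d) q
          ∎)
        where
        open ≡-Reasoning
        by-layer : ∀ J → 𝟙 (does (layer? d J)) * exactly J ≡ 𝟙 (does (layer? d J)) * (atLeast J - atLeast full)
        by-layer J = on-layer? (layer? d J)
          where
          on-layer? : (J∈? : Dec (∣ J ∣ ℕ.+ d ≡ n)) →
                      𝟙 (does J∈?) * exactly J ≡ 𝟙 (does J∈?) * (atLeast J - atLeast full)
          on-layer? (yes on-layer) = cong (1ℤ *_) (exactly-on-layer J on-layer)
          on-layer? (no _)         = refl

    coefficients-agree : ∀ e → coeffZ (fPoly d) e ≡ coeffZ (rhsPoly d) e
    coefficients-agree = coeffZ-unique (fPoly d) (rhsPoly d) modulus N<modulus Layers.evalZ-agree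

proposition3p10 : ∀ {k n : ℕ} (G : Mat k n) → NoZeroColumn G → (s : SNFs G)
    → ∀ (m : ℕ) → 1 ≤ m → m ≤ ρ₀ G s
    → ∀ (d : ℕ) → IsD' G s m d
    → f G s d m ≈P rhs G s d m
proposition3p10 G _ s m 1≤m m≤ρ₀ d d-minimal e = begin
  coeff (f G s d m) e         ≡⟨ cong (λ P → coeff P e) (f≡scale d) ⟩
  coeff (scale (fPoly d)) e   ≡⟨ coeff-scale (fPoly d) e ⟩
  φ (coeffZ (fPoly d) e)      ≡⟨ cong φ (coefficients-agree e) ⟩
  φ (coeffZ (rhsPoly d) e)    ≡⟨ coeff-scale (rhsPoly d) e ⟨
  coeff (scale (rhsPoly d)) e ≡⟨ cong (λ P → coeff P e) (rhs≡scale d) ⟨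
  coeff (rhs G s d m) e       ∎
  where
  open ≡-Reasoning
  open Proof G s m 1≤m m≤ρ₀
  open Minimal d d-minimal
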